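{- For $N\ge0$ and $\mu\in\{0,2\}$, with all unspecified sums over $(i,j,k,l)\in\mathbb{N}^4$ with $i+j+k+l=N$ and $\begin{bmatrix}N\\ i,j,k,l\end{bmatrix}=\begin{bmatrix}N\\ i,j,k,l\end{bmatrix}_{q^6}$: $$P_{3N+\mu}(0,t,u,0;q)=\Big(1+\tfrac{\mu}{2}tq^2\Big)\sum\begin{bmatrix}N\\ i,j,k,l\end{bmatrix}t^iu^jq^{3i^2+(3\mu-1)i+3j^2+j+3k},$$ $$P_{3N+\mu}(s,0,0,v;q)=\Big(1+\tfrac{\mu}{2}sq\Big)\sum\begin{bmatrix}N\\ i,j,k,l\end{bmatrix}s^iv^jq^{3i^2+(3\mu-2)i+3j^2+2j+3k},$$ $$P_{3N+\mu}(s,0,u,0;q)=\Big(1+\tfrac{\mu}{2}sq\Big)\sum\begin{bmatrix}N\\ i,j,k,l\end{bmatrix}s^iu^jq^{3i^2+(3\mu-2)i+3j^2+j+3k},$$ $$P_{3N+\mu}(0,t,0,v;q)=\Big(1+\tfrac{\mu}{2}tq^2\Big)\sum\begin{bmatrix}N\\ i,j,k,l\end{bmatrix}t^iv^jq^{3i^2+(3\mu-1)i+3j^2+2j+3k},$$ and $$P_{3N+1}(0,t,u,0;q)=\sum\begin{bmatrix}N\\ i,j,k,l\end{bmatrix}t^iu^jq^{3i^2-i+3j^2+j+3k},$$ $$P_{3N+1}(s,0,0,v;q)=\sum\begin{bmatrix}N\\ i,j,k,l\end{bmatrix}q^{3i^2-2i+3j^2+2j+3k}\big(s^iv^j+s^{j+1}v^iq^{i-j+3N+1}\big),$$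 $$P_{3N+1}(s,0,u,0;q)=\sum\begin{bmatrix}N\\ i,j,k,l\end{bmatrix}q^{3i^2-2i+3j^2+j+3k}\big(s^iu^j+s^{j+1}u^iq^{3N+1}\big),$$ $$P_{3N+1}(0,t,0,v;q)=\sum\begin{bmatrix}N\\ i,j,k,l\end{bmatrix}t^iv^jq^{3i^2-i+3j^2+2j+3k}.$$
   Context: For $M\ge0$, $\mathcal{DS}^3_{M,\infty}$ is the set of partitions into distinct parts with largest part $\le M$ in which for no $l\ge0$ are both $3l+1$ and $3l+2$ parts. For $\pi=(\pi_1>\pi_2>\cdots)$ and $i=1,2$, $o_i(\pi)$ (resp. $e_i(\pi)$) is the number of odd-indexed parts $\pi_1,\pi_3,\dots$ (resp. even-indexed parts $\pi_2,\pi_4,\dots$) that are $\equiv i\pmod 3$. Define $P_{M}(s,t,u,v;q)=\sum_{\pi\in\mathcal{DS}^3_{M,\infty}}s^{o_1(\pi)}t^{o_2(\pi)}u^{e_1(\pi)}v^{e_2(\pi)}q^{|\pi|}$, where $|\pi|$ is the sum of parts. $q$-multinomial: $\begin{bmatrix}N\\ n_1,\dots,n_m\end{bmatrix}_q=\frac{(q;q)_N}{(q;q)_{n_1}\cdots(q;q)_{n_m}}$, $(q;q)_n=\prod_{i=1}^n(1-q^i)$. -}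

module Defs where

open import Data.Nat as ℕ using (ℕ; zero; suc; _∸_; _%_; _≡ᵇ_)
open import Data.Bool using (Bool; true; false; not; _∧_; _∨_)
open import Data.List using (List; []; _∷_; _++_; map; filterᵇ)
open import Data.Bool.ListAction using (any)
open import Data.Integer using (+_)
open import Data.Rational using (ℚ; 0ℚ; 1ℚ; _+_; _*_; _-_; 1/_; ≢-nonZero)
import Data.Rational as ℚ
open import Data.Rational.Properties using (_≟_)
open import Relation.Nullary using (yes; no)

⟦_⟧ : ℕ → ℚ
⟦ n ⟧ = ℚ._/_ (+ n) 1

_^_ : ℚ → ℕ → ℚ
x ^ zero  = 1ℚ
x ^ suc n = x * (x ^ n)

-- total inverse (inv 0 = 0); only ever applied to nonzero values
-- under the hypotheses of the theorem
inv : ℚ → ℚ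
inv p with p ≟ 0ℚ
... | yes _  = 0ℚ
... | no p≢0 = 1/_ p {{≢-nonZero p≢0}}

qPoch : ℚ → ℕ → ℚ
qPoch q zero    = 1ℚ
qPoch q (suc n) = qPoch q n * (1ℚ - q ^ suc n)

qMultinom4 : ℚ → ℕ → ℕ → ℕ → ℕ → ℕ → ℚ
qMultinom4 q N i j k l =
  qPoch q N * inv (qPoch q i * qPoch q j * qPoch q k * qPoch q l)

sumℚ : List ℚ → ℚ
sumℚ []       = 0ℚ
sumℚ (x ∷ xs) = x + sumℚ xs

sumUpTo : ℕ → (ℕ → ℚ) → ℚ
sumUpTo zero    f = f zero
sumUpTo (suc n) f = sumUpTo n f + f (suc n)

sum4 : ℕ → (ℕ → ℕ → ℕ → ℕ → ℚ) → ℚ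
sum4 N f =
  sumUpTo N λ i →
  sumUpTo (N ∸ i) λ j →
  sumUpTo (N ∸ i ∸ j) λ k →
  f i j k (N ∸ i ∸ j ∸ k)

-- Partitions into distinct parts with largest part ≤ M, as lists of
-- parts in strictly decreasing order (π₁ > π₂ > ⋯ ≥ 1).

distinctParts : ℕ → List (List ℕ)
distinctParts zero    = [] ∷ []
distinctParts (suc m) = distinctParts m ++ map (suc m ∷_) (distinctParts m)

elemᵇ : ℕ → List ℕ → Bool
elemᵇ x []       = false
elemᵇ x (y ∷ ys) = (x ≡ᵇ y) ∨ elemᵇ x ys

-- true iff for no l ≥ 0 are both 3l+1 and 3l+2 parts of π
-- (i.e. no part p ≡ 1 (mod 3) with p+1 also a part)
noAdjacent12 : List ℕ → Bool
noAdjacent12 π = not (any (λ p → ((p % 3) ≡ᵇ 1) ∧ elemᵇ (suc p) π) π)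

DS3 : ℕ → List (List ℕ)
DS3 M = filterᵇ noAdjacent12 (distinctParts M)

-- weight s^{o₁} t^{o₂} u^{e₁} v^{e₂} q^{|π|}: the first part is at an
-- odd index (weights s,t); the roles swap to (u,v) for the next part, etc.
weight : ℚ → ℚ → ℚ → ℚ → ℚ → List ℕ → ℚ
weight s t u v q []       = 1ℚ
weight s t u v q (p ∷ ps) = colour (p % 3) * (q ^ p) * weight u v s t q ps
  where
  colour : ℕ → ℚ
  colour 1 = s
  colour 2 = t
  colour _ = 1ℚ

P : ℕ → ℚ → ℚ → ℚ → ℚ → ℚ → ℚ
P M s t u v q = sumℚ (map (weight s t u v q) (DS3 M))

-- Removing the largest part of a partition swaps its odd- and even-indexed parts, so deleting
-- the parts 3N+3, 3N+2, 3N+1 expresses P_{3N+3}(s,t,u,v) through P_{3N}(s,t,u,v) and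
-- P_{3N}(u,v,s,t); the part 3N+2 may only be added to partitions avoiding 3N+1. When one of
-- s,t and one of u,v vanish, the two families involved are exchanged by this swap, and the
-- recurrence in N they satisfy is the one satisfied by the multinomial sums on the right: the
-- q-Pascal rule for [N+1; i,j,k,l]_{q⁶}, obtained by telescoping 1 − q^{6(N+1)} over the four
-- indices, produces a sum weighted by q^{6(i+l)}, which the symmetry (i,j,k,l) ↦ (j,i,l,k)
-- turns back into the sum of the swapped family. The cases 3N+1 and 3N+2 follow by one more
-- step of the partition recurrence.

module Submission where

open import Data.Rational using (ℚ)

module RationalArithmetic where
  open import Defs using (_^_; inv)
  open import Data.Nat using (ℕ; zero; suc) renaming (_+_ to _+ℕ_; _*_ to _*ℕ_)
  import Data.Nat.Properties as ℕ
  open import Data.Rational using (0ℚ; 1ℚ; _*_; _-_; 1/_; ≢-nonZero)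
  open import Data.Rational.Properties
    using (_≟_; +-0-group; *-assoc; *-comm; *-identityˡ; *-zeroˡ; *-zeroʳ; *-inverseˡ; *-inverseʳ)
  open import Data.Rational.Solver using (module +-*-Solver)
  open +-*-Solver
  open import Algebra.Properties.Group +-0-group using (x∙y⁻¹≈ε⇒x≈y)
  open import Relation.Binary.PropositionalEquality
  open import Relation.Nullary using (yes; no; contradiction)
  open ≡-Reasoning

  ^-distribˡ-+-* : ∀ x m n → x ^ (m +ℕ n) ≡ x ^ m * x ^ n
  ^-distribˡ-+-* x zero    n = sym (*-identityˡ _)
  ^-distribˡ-+-* x (suc m) n = trans (cong (x *_) (^-distribˡ-+-* x m n)) (sym (*-assoc x _ _))

  ^-*-assoc : ∀ x m n → (x ^ m) ^ n ≡ x ^ (m *ℕ n)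
  ^-*-assoc x m zero    = cong (x ^_) (sym (ℕ.*-zeroʳ m))
  ^-*-assoc x m (suc n) = begin
    x ^ m * (x ^ m) ^ n   ≡⟨ cong (x ^ m *_) (^-*-assoc x m n) ⟩
    x ^ m * x ^ (m *ℕ n)  ≡⟨ sym (^-distribˡ-+-* x m (m *ℕ n)) ⟩
    x ^ (m +ℕ m *ℕ n)     ≡⟨ cong (x ^_) (sym (ℕ.*-suc m n)) ⟩
    x ^ (m *ℕ suc n)      ∎

  ^-distribʳ-* : ∀ x y n → (x * y) ^ n ≡ x ^ n * y ^ n
  ^-distribʳ-* x y zero    = refl
  ^-distribʳ-* x y (suc n) = trans (cong (x * y *_) (^-distribʳ-* x y n))
    (solve 4 (λ x y a b → x :* y :* (a :* b) := x :* a :* (y :* b)) refl x y (x ^ n) (y ^ n))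

  *-cancelˡ-≢0 : ∀ {c a b} → c ≢ 0ℚ → c * a ≡ c * b → a ≡ b
  *-cancelˡ-≢0 {c} {a} {b} c≢0 ca≡cb =
    trans (sym (c⁻¹*[c*x]≡x a)) (trans (cong (1/ c *_) ca≡cb) (c⁻¹*[c*x]≡x b))
    where
    instance _ = ≢-nonZero c≢0
    c⁻¹*[c*x]≡x : ∀ x → 1/ c * (c * x) ≡ x
    c⁻¹*[c*x]≡x x = begin
      1/ c * (c * x)  ≡⟨ sym (*-assoc (1/ c) c x) ⟩
      1/ c * c * x    ≡⟨ cong (_* x) (*-inverseˡ c) ⟩
      1ℚ * x          ≡⟨ *-identityˡ x ⟩
      x               ∎

  1-x≢0 : ∀ x → x ≢ 1ℚ → 1ℚ - x ≢ 0ℚ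
  1-x≢0 x x≢1 1-x≡0 = x≢1 (sym (x∙y⁻¹≈ε⇒x≈y 1ℚ x 1-x≡0))

  inv-*-cancelʳ : ∀ X e → e ≢ 0ℚ → inv (X * e) * e ≡ inv X
  inv-*-cancelʳ X e e≢0 with X ≟ 0ℚ | X * e ≟ 0ℚ
  ... | yes X≡0 | yes _    = *-zeroˡ e
  ... | yes X≡0 | no Xe≢0  = contradiction (trans (cong (_* e) X≡0) (*-zeroˡ e)) Xe≢0
  ... | no X≢0  | yes Xe≡0 = contradiction (*-cancelˡ-≢0 e≢0 (trans (*-comm e X) (trans Xe≡0 (sym (*-zeroʳ e))))) X≢0
  ... | no X≢0  | no Xe≢0  = *-cancelˡ-≢0 X≢0 (begin
    X * (1/ (X * e) * e)  ≡⟨ solve 3 (λ X e r → X :* (r :* e) := r :* (X :* e)) refl X e (1/ (X * e)) ⟩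
    1/ (X * e) * (X * e)  ≡⟨ *-inverseˡ (X * e) ⟩
    1ℚ                    ≡⟨ sym (*-inverseʳ X) ⟩
    X * 1/ X              ∎)
    where
    instance
      _ = ≢-nonZero X≢0
      _ = ≢-nonZero Xe≢0

module SimplexSums where
  open import Defs using (sumUpTo; sum4)
  open import Data.Nat using (ℕ; zero; suc; _∸_; _≤_; z≤n) renaming (_+_ to _+ℕ_)
  import Data.Nat.Properties as ℕ
  open import Data.Rational using (ℚ; 0ℚ; _+_; _*_)
  open import Data.Rational.Properties using (+-identityˡ; +-identityʳ; +-comm; +-assoc)
  open import Data.Rational.Solver using (module +-*-Solver)
  open +-*-Solver
  open import Function using (_∘_)
  open import Relation.Binary.PropositionalEquality
  open ≡-Reasoning

  sumUpTo-cong : ∀ n {f g : ℕ → ℚ} → (∀ a → a ≤ n → f a ≡ g a) → sumUpTo n f ≡ sumUpTo n g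
  sumUpTo-cong zero    f≡g = f≡g 0 z≤n
  sumUpTo-cong (suc n) f≡g =
    cong₂ _+_ (sumUpTo-cong n (λ a a≤n → f≡g a (ℕ.m≤n⇒m≤1+n a≤n))) (f≡g (suc n) ℕ.≤-refl)

  sumUpTo-+ : ∀ n (f g : ℕ → ℚ) → sumUpTo n (λ a → f a + g a) ≡ sumUpTo n f + sumUpTo n g
  sumUpTo-+ zero    f g = refl
  sumUpTo-+ (suc n) f g = trans (cong (_+ (f (suc n) + g (suc n))) (sumUpTo-+ n f g))
    (solve 4 (λ F G x y → (F :+ G) :+ (x :+ y) := (F :+ x) :+ (G :+ y)) refl
      (sumUpTo n f) (sumUpTo n g) (f (suc n)) (g (suc n)))

  sumUpTo-* : ∀ n c (f : ℕ → ℚ) → sumUpTo n (λ a → c * f a) ≡ c * sumUpTo n f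
  sumUpTo-* zero    c f = refl
  sumUpTo-* (suc n) c f = trans (cong (_+ c * f (suc n)) (sumUpTo-* n c f))
    (solve 3 (λ c F x → c :* F :+ c :* x := c :* (F :+ x)) refl c (sumUpTo n f) (f (suc n)))

  sumUpTo-zero : ∀ n {f : ℕ → ℚ} → (∀ a → f a ≡ 0ℚ) → sumUpTo n f ≡ 0ℚ
  sumUpTo-zero zero    f≡0 = f≡0 0
  sumUpTo-zero (suc n) f≡0 = trans (cong₂ _+_ (sumUpTo-zero n f≡0) (f≡0 (suc n))) (+-identityʳ 0ℚ)

  sumUpTo-front : ∀ n (f : ℕ → ℚ) → sumUpTo (suc n) f ≡ f 0 + sumUpTo n (f ∘ suc)
  sumUpTo-front zero    f = refl
  sumUpTo-front (suc n) f = trans (cong (_+ f (suc (suc n))) (sumUpTo-front n f))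
    (+-assoc (f 0) (sumUpTo n (f ∘ suc)) (f (suc (suc n))))

  -- Iterating nest sums over the compositions x₁ + ⋯ + x_d = n; Defs' sum4 is definitionally nest sum3.
  nest : {A : Set} → (ℕ → A → ℚ) → ℕ → (ℕ → A) → ℚ
  nest S n f = sumUpTo n (λ a → S (n ∸ a) (f a))

  sum2 : ℕ → (ℕ → ℕ → ℚ) → ℚ
  sum2 = nest (λ m g → g m)

  sum3 : ℕ → (ℕ → ℕ → ℕ → ℚ) → ℚ
  sum3 = nest sum2

  suc-∸ : ∀ {n a} → a ≤ n → suc n ∸ a ≡ suc (n ∸ a)
  suc-∸ a≤n = ℕ.+-∸-assoc 1 a≤n

  sum2-back : ∀ n f → sum2 (suc n) f ≡ sum2 n (λ k l → f k (suc l)) + f (suc n) 0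
  sum2-back n f =
    cong₂ _+_ (sumUpTo-cong n (λ k k≤n → cong (f k) (suc-∸ k≤n))) (cong (f (suc n)) (ℕ.n∸n≡0 n))

  nest-back : {A B : Set} (S : ℕ → A → ℚ) (S′ : ℕ → B → ℚ) (shift : A → A) (at0 : A → B) →
    (∀ m g → S (suc m) g ≡ S m (shift g) + S′ (suc m) (at0 g)) → (∀ g → S 0 g ≡ S′ 0 (at0 g)) →
    ∀ n f → nest S (suc n) f ≡ nest S n (shift ∘ f) + nest S′ (suc n) (at0 ∘ f)
  nest-back S S′ shift at0 S-back S-base n f = begin
    sumUpTo n (λ a → S (suc n ∸ a) (f a)) + S (n ∸ n) (f (suc n))
      ≡⟨ cong₂ _+_ (sumUpTo-cong n λ a a≤n → trans (cong (λ m → S m (f a)) (suc-∸ a≤n)) (S-back (n ∸ a) (f a)))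
                   (trans (cong (λ m → S m (f (suc n))) (ℕ.n∸n≡0 n)) (S-base (f (suc n)))) ⟩
    sumUpTo n (λ a → S (n ∸ a) (shift (f a)) + S′ (suc (n ∸ a)) (at0 (f a))) + S′ 0 (at0 (f (suc n)))
      ≡⟨ cong (_+ S′ 0 (at0 (f (suc n)))) (sumUpTo-+ n _ _) ⟩
    nest S n (shift ∘ f) + sumUpTo n (λ a → S′ (suc (n ∸ a)) (at0 (f a))) + S′ 0 (at0 (f (suc n)))
      ≡⟨ +-assoc (nest S n (shift ∘ f)) _ _ ⟩
    nest S n (shift ∘ f) + (sumUpTo n (λ a → S′ (suc (n ∸ a)) (at0 (f a))) + S′ 0 (at0 (f (suc n))))
      ≡⟨ cong (λ m → nest S n (shift ∘ f) + (m + S′ 0 (at0 (f (suc n)))))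
              (sumUpTo-cong n λ a a≤n → cong (λ m → S′ m (at0 (f a))) (sym (suc-∸ a≤n))) ⟩
    nest S n (shift ∘ f) + (sumUpTo n (λ a → S′ (suc n ∸ a) (at0 (f a))) + S′ 0 (at0 (f (suc n))))
      ≡⟨ cong (λ m → nest S n (shift ∘ f) + (sumUpTo n (λ a → S′ (suc n ∸ a) (at0 (f a))) + S′ m (at0 (f (suc n)))))
              (sym (ℕ.n∸n≡0 n)) ⟩
    nest S n (shift ∘ f) + nest S′ (suc n) (at0 ∘ f) ∎

  sum3-back : ∀ n f → sum3 (suc n) f ≡ sum3 n (λ j k l → f j k (suc l)) + sum2 (suc n) (λ j k → f j k 0)
  sum3-back = nest-back sum2 (λ m g → g m) (λ g k l → g k (suc l)) (λ g k → g k 0) sum2-back (λ _ → refl)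

  sum4-back : ∀ n f → sum4 (suc n) f ≡ sum4 n (λ i j k l → f i j k (suc l)) + sum3 (suc n) (λ i j k → f i j k 0)
  sum4-back = nest-back sum3 sum2 (λ g j k l → g j k (suc l)) (λ g j k → g j k 0) sum3-back (λ _ → refl)

  sum2-flip : ∀ n f → sum2 n f ≡ sum2 n (λ k l → f l k)
  sum2-flip zero    f = refl
  sum2-flip (suc n) f = begin
    sum2 (suc n) f                          ≡⟨ sumUpTo-front n _ ⟩
    f 0 (suc n) + sum2 n (f ∘ suc)          ≡⟨ cong (f 0 (suc n) +_) (sum2-flip n (f ∘ suc)) ⟩
    f 0 (suc n) + sum2 n (λ k l → f (suc l) k) ≡⟨ +-comm (f 0 (suc n)) _ ⟩
    sum2 n (λ k l → f (suc l) k) + f 0 (suc n) ≡⟨ sym (sum2-back n (λ k l → f l k)) ⟩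
    sum2 (suc n) (λ k l → f l k)            ∎

  sum3-swap : ∀ n f → sum3 n f ≡ sum3 n (λ j k l → f k j l)
  sum3-swap zero    f = refl
  sum3-swap (suc n) f = begin
    sum3 (suc n) f
      ≡⟨ sum3-back n f ⟩
    sum3 n (λ j k l → f j k (suc l)) + sum2 (suc n) (λ j k → f j k 0)
      ≡⟨ cong₂ _+_ (sum3-swap n (λ j k l → f j k (suc l))) (sum2-flip (suc n) (λ j k → f j k 0)) ⟩
    sum3 n (λ j k l → f k j (suc l)) + sum2 (suc n) (λ j k → f k j 0)
      ≡⟨ sym (sum3-back n (λ j k l → f k j l)) ⟩
    sum3 (suc n) (λ j k l → f k j l) ∎

  sum4-sym : ∀ n f → sum4 n f ≡ sum4 n (λ i j k l → f j i l k)
  sum4-sym n f = trans (sum3-swap n (λ i j m → sum2 m (f i j)))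
    (sumUpTo-cong n λ i _ → sumUpTo-cong (n ∸ i) λ j _ → sum2-flip (n ∸ i ∸ j) (f j i))

  sum4-cong : ∀ n {f g} → (∀ i j k l → i +ℕ (j +ℕ (k +ℕ l)) ≡ n → f i j k l ≡ g i j k l) →
    sum4 n f ≡ sum4 n g
  sum4-cong n f≡g =
    sumUpTo-cong n λ i i≤n → sumUpTo-cong (n ∸ i) λ j j≤ → sumUpTo-cong (n ∸ i ∸ j) λ k k≤ →
    f≡g i j k _ (trans (cong (i +ℕ_) (trans (cong (j +ℕ_) (ℕ.m+[n∸m]≡n k≤)) (ℕ.m+[n∸m]≡n j≤)))
                       (ℕ.m+[n∸m]≡n i≤n))

  sum4-+ : ∀ n f g → sum4 n (λ i j k l → f i j k l + g i j k l) ≡ sum4 n f + sum4 n g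
  sum4-+ n f g = trans (sumUpTo-cong n λ i _ → sum3-+ (n ∸ i) (f i) (g i)) (sumUpTo-+ n _ _)
    where
    sum2-+ : ∀ n f g → sum2 n (λ k l → f k l + g k l) ≡ sum2 n f + sum2 n g
    sum2-+ n f g = sumUpTo-+ n _ _
    sum3-+ : ∀ n f g → sum3 n (λ j k l → f j k l + g j k l) ≡ sum3 n f + sum3 n g
    sum3-+ n f g = trans (sumUpTo-cong n λ j _ → sum2-+ (n ∸ j) (f j) (g j)) (sumUpTo-+ n _ _)

  sum4-* : ∀ n c f → sum4 n (λ i j k l → c * f i j k l) ≡ c * sum4 n f
  sum4-* n c f = trans (sumUpTo-cong n λ i _ → sum3-* (n ∸ i) (f i)) (sumUpTo-* n c _)
    where
    sum3-* : ∀ n f → sum3 n (λ j k l → c * f j k l) ≡ c * sum3 n f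
    sum3-* n f = trans (sumUpTo-cong n λ j _ → sumUpTo-* (n ∸ j) c _) (sumUpTo-* n c _)

  sum3-zero : ∀ n {f} → (∀ j k l → f j k l ≡ 0ℚ) → sum3 n f ≡ 0ℚ
  sum3-zero n f≡0 = sumUpTo-zero n λ j → sumUpTo-zero (n ∸ j) λ k → f≡0 j k _

  sum4-shiftᵢ : ∀ n f → (∀ j k l → f 0 j k l ≡ 0ℚ) → sum4 (suc n) f ≡ sum4 n (f ∘ suc)
  sum4-shiftᵢ n f f₀≡0 =
    trans (sumUpTo-front n _) (trans (cong (_+ sum4 n (f ∘ suc)) (sum3-zero (suc n) f₀≡0)) (+-identityˡ _))

  sum4-shiftₗ : ∀ n f → (∀ i j k → f i j k 0 ≡ 0ℚ) → sum4 (suc n) f ≡ sum4 n (λ i j k l → f i j k (suc l))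
  sum4-shiftₗ n f f₀≡0 =
    trans (sum4-back n f) (trans (cong (sum4 n (λ i j k l → f i j k (suc l)) +_) (sum3-zero (suc n) f₀≡0))
      (+-identityʳ _))

  sum4-split : ∀ n f g h c → (∀ i j k l → i +ℕ (j +ℕ (k +ℕ l)) ≡ n → f i j k l ≡ g i j k l + c * h i j k l) →
    sum4 n f ≡ sum4 n g + c * sum4 n h
  sum4-split n f g h c f≡g+ch =
    trans (sum4-cong n f≡g+ch) (trans (sum4-+ n g (λ i j k l → c * h i j k l)) (cong (sum4 n g +_) (sum4-* n c h)))

module QMultinomial (Q : ℚ) where
  open import Defs using (_^_; inv; qPoch; qMultinom4; sum4)
  open import Data.Nat using (ℕ; suc; z≤n; s≤s) renaming (_+_ to _+ℕ_; _≤_ to _≤ℕ_)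
  import Data.Nat.Properties as ℕ
  open import Data.Rational using (ℚ; 0ℚ; 1ℚ; _+_; _*_; _-_)
  open import Data.Rational.Properties using (*-zeroˡ; *-zeroʳ)
  open import Data.Rational.Solver using (module +-*-Solver)
  open +-*-Solver
  open import Relation.Binary.PropositionalEquality
  open ≡-Reasoning
  open RationalArithmetic
  open SimplexSums

  NoRootOfUnityUpTo : ℕ → Set
  NoRootOfUnityUpTo N = ∀ m → 1 ≤ℕ m → m ≤ℕ N → Q ^ m ≢ 1ℚ

  private
    M : ℕ → ℕ → ℕ → ℕ → ℕ → ℚ
    M = qMultinom4 Q

    poch : ℕ → ℚ
    poch = qPoch Q

  qMultinom4-sym : ∀ n i j k l → M n j i l k ≡ M n i j k l
  qMultinom4-sym n i j k l = cong (λ D → poch n * inv D)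
    (solve 4 (λ a b c d → b :* a :* d :* c := a :* b :* c :* d) refl (poch i) (poch j) (poch k) (poch l))

  private
    multinom-step : ∀ n (D D′ e g : ℚ) → D′ ≡ D * e → e ≢ 0ℚ →
      poch (suc n) * inv D′ * (e * g) ≡ (1ℚ - Q ^ suc n) * (poch n * inv D * g)
    multinom-step n D D′ e g refl e≢0 = begin
      poch n * c * inv (D * e) * (e * g)
        ≡⟨ solve 5 (λ P c I e g → P :* c :* I :* (e :* g) := c :* (P :* (I :* e) :* g)) refl (poch n) c (inv (D * e)) e g ⟩
      c * (poch n * (inv (D * e) * e) * g)
        ≡⟨ cong (λ x → c * (poch n * x * g)) (inv-*-cancelʳ D e e≢0) ⟩
      c * (poch n * inv D * g) ∎
      where c = 1ℚ - Q ^ suc n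

    1-Q^≢0 : ∀ {n} → NoRootOfUnityUpTo (suc n) → ∀ m → m ≤ℕ n → 1ℚ - Q ^ suc m ≢ 0ℚ
    1-Q^≢0 h m m≤n = 1-x≢0 _ (h (suc m) (s≤s z≤n) (s≤s m≤n))

  qMultinom4-sucᵢ : ∀ {n} → NoRootOfUnityUpTo (suc n) → ∀ i j k l g → i ≤ℕ n →
    M (suc n) (suc i) j k l * ((1ℚ - Q ^ suc i) * g) ≡ (1ℚ - Q ^ suc n) * (M n i j k l * g)
  qMultinom4-sucᵢ {n} h i j k l g i≤n =
    multinom-step n (poch i * poch j * poch k * poch l) _ (1ℚ - Q ^ suc i) g
      (solve 5 (λ a b c d e → a :* e :* b :* c :* d := a :* b :* c :* d :* e) refl (poch i) (poch j) (poch k) (poch l) _)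
      (1-Q^≢0 h i i≤n)

  qMultinom4-sucₗ : ∀ {n} → NoRootOfUnityUpTo (suc n) → ∀ i j k l g → l ≤ℕ n →
    M (suc n) i j k (suc l) * ((1ℚ - Q ^ suc l) * g) ≡ (1ℚ - Q ^ suc n) * (M n i j k l * g)
  qMultinom4-sucₗ {n} h i j k l g l≤n =
    multinom-step n (poch i * poch j * poch k * poch l) _ (1ℚ - Q ^ suc l) g
      (solve 5 (λ a b c d e → a :* b :* c :* (d :* e) := a :* b :* c :* d :* e) refl (poch i) (poch j) (poch k) (poch l) _)
      (1-Q^≢0 h l l≤n)

  sum4-mirror : ∀ n (F : ℕ → ℕ → ℕ → ℕ → ℚ) →
    sum4 n (λ i j k l → M n i j k l * F i j k l) ≡ sum4 n (λ i j k l → M n i j k l * F j i l k)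
  sum4-mirror n F = trans (sum4-sym n (λ i j k l → M n i j k l * F i j k l))
    (sum4-cong n λ i j k l _ → cong (_* F j i l k) (qMultinom4-sym n i j k l))

  private
    vanish : ∀ m G → m * ((1ℚ - Q ^ 0) * G) ≡ 0ℚ
    vanish m G = trans (cong (m *_) (*-zeroˡ G)) (*-zeroʳ m)

    first≤ : ∀ {i r n} → i +ℕ r ≡ n → i ≤ℕ n
    first≤ {i} {r} refl = ℕ.m≤m+n i r

    last≤ : ∀ {i j k l n} → i +ℕ (j +ℕ (k +ℕ l)) ≡ n → l ≤ℕ n
    last≤ {i} {j} {k} {l} refl = ℕ.≤-trans (ℕ.m≤n+m l k) (ℕ.≤-trans (ℕ.m≤n+m _ j) (ℕ.m≤n+m _ i))

  module _ {n} (h : NoRootOfUnityUpTo (suc n)) where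

    sum4-multinom-shiftᵢ : ∀ (G : ℕ → ℕ → ℕ → ℕ → ℚ) →
      sum4 (suc n) (λ i j k l → M (suc n) i j k l * ((1ℚ - Q ^ i) * G i j k l))
        ≡ (1ℚ - Q ^ suc n) * sum4 n (λ i j k l → M n i j k l * G (suc i) j k l)
    sum4-multinom-shiftᵢ G = begin
      sum4 (suc n) (λ i j k l → M (suc n) i j k l * ((1ℚ - Q ^ i) * G i j k l))
        ≡⟨ sum4-shiftᵢ n (λ i j k l → M (suc n) i j k l * ((1ℚ - Q ^ i) * G i j k l))
             (λ j k l → vanish (M (suc n) 0 j k l) (G 0 j k l)) ⟩
      sum4 n (λ i j k l → M (suc n) (suc i) j k l * ((1ℚ - Q ^ suc i) * G (suc i) j k l))
        ≡⟨ sum4-cong n (λ i j k l e → qMultinom4-sucᵢ h i j k l (G (suc i) j k l) (first≤ {i} e)) ⟩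
      sum4 n (λ i j k l → (1ℚ - Q ^ suc n) * (M n i j k l * G (suc i) j k l))
        ≡⟨ sum4-* n (1ℚ - Q ^ suc n) (λ i j k l → M n i j k l * G (suc i) j k l) ⟩
      (1ℚ - Q ^ suc n) * sum4 n (λ i j k l → M n i j k l * G (suc i) j k l) ∎

    sum4-multinom-shiftₗ : ∀ (G : ℕ → ℕ → ℕ → ℕ → ℚ) →
      sum4 (suc n) (λ i j k l → M (suc n) i j k l * ((1ℚ - Q ^ l) * G i j k l))
        ≡ (1ℚ - Q ^ suc n) * sum4 n (λ i j k l → M n i j k l * G i j k (suc l))
    sum4-multinom-shiftₗ G = begin
      sum4 (suc n) (λ i j k l → M (suc n) i j k l * ((1ℚ - Q ^ l) * G i j k l))
        ≡⟨ sum4-shiftₗ n (λ i j k l → M (suc n) i j k l * ((1ℚ - Q ^ l) * G i j k l))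
             (λ i j k → vanish (M (suc n) i j k 0) (G i j k 0)) ⟩
      sum4 n (λ i j k l → M (suc n) i j k (suc l) * ((1ℚ - Q ^ suc l) * G i j k (suc l)))
        ≡⟨ sum4-cong n (λ i j k l e → qMultinom4-sucₗ h i j k l (G i j k (suc l)) (last≤ {i} {j} {k} e)) ⟩
      sum4 n (λ i j k l → (1ℚ - Q ^ suc n) * (M n i j k l * G i j k (suc l)))
        ≡⟨ sum4-* n (1ℚ - Q ^ suc n) (λ i j k l → M n i j k l * G i j k (suc l)) ⟩
      (1ℚ - Q ^ suc n) * sum4 n (λ i j k l → M n i j k l * G i j k (suc l)) ∎

    sum4-multinom-shiftⱼ : ∀ (G : ℕ → ℕ → ℕ → ℕ → ℚ) →
      sum4 (suc n) (λ i j k l → M (suc n) i j k l * ((1ℚ - Q ^ j) * G i j k l))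
        ≡ (1ℚ - Q ^ suc n) * sum4 n (λ i j k l → M n i j k l * G i (suc j) k l)
    sum4-multinom-shiftⱼ G = begin
      sum4 (suc n) (λ i j k l → M (suc n) i j k l * ((1ℚ - Q ^ j) * G i j k l))
        ≡⟨ sum4-mirror (suc n) (λ i j k l → (1ℚ - Q ^ j) * G i j k l) ⟩
      sum4 (suc n) (λ i j k l → M (suc n) i j k l * ((1ℚ - Q ^ i) * G j i l k))
        ≡⟨ sum4-multinom-shiftᵢ (λ i j k l → G j i l k) ⟩
      (1ℚ - Q ^ suc n) * sum4 n (λ i j k l → M n i j k l * G j (suc i) l k)
        ≡⟨ cong ((1ℚ - Q ^ suc n) *_) (sum4-mirror n (λ i j k l → G j (suc i) l k)) ⟩
      (1ℚ - Q ^ suc n) * sum4 n (λ i j k l → M n i j k l * G i (suc j) k l) ∎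

    sum4-multinom-shiftₖ : ∀ (G : ℕ → ℕ → ℕ → ℕ → ℚ) →
      sum4 (suc n) (λ i j k l → M (suc n) i j k l * ((1ℚ - Q ^ k) * G i j k l))
        ≡ (1ℚ - Q ^ suc n) * sum4 n (λ i j k l → M n i j k l * G i j (suc k) l)
    sum4-multinom-shiftₖ G = begin
      sum4 (suc n) (λ i j k l → M (suc n) i j k l * ((1ℚ - Q ^ k) * G i j k l))
        ≡⟨ sum4-mirror (suc n) (λ i j k l → (1ℚ - Q ^ k) * G i j k l) ⟩
      sum4 (suc n) (λ i j k l → M (suc n) i j k l * ((1ℚ - Q ^ l) * G j i l k))
        ≡⟨ sum4-multinom-shiftₗ (λ i j k l → G j i l k) ⟩
      (1ℚ - Q ^ suc n) * sum4 n (λ i j k l → M n i j k l * G j i (suc l) k)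
        ≡⟨ cong ((1ℚ - Q ^ suc n) *_) (sum4-mirror n (λ i j k l → G j i (suc l) k)) ⟩
      (1ℚ - Q ^ suc n) * sum4 n (λ i j k l → M n i j k l * G i j (suc k) l) ∎

    sum4-multinom-suc : ∀ (F : ℕ → ℕ → ℕ → ℕ → ℚ) →
      sum4 (suc n) (λ i j k l → M (suc n) i j k l * F i j k l)
        ≡ sum4 n (λ i j k l → M n i j k l * (Q ^ (i +ℕ (k +ℕ l)) * F i (suc j) k l))
          + sum4 n (λ i j k l → M n i j k l * (Q ^ l * F (suc i) j k l))
          + sum4 n (λ i j k l → M n i j k l * (Q ^ (i +ℕ l) * F i j (suc k) l))
          + sum4 n (λ i j k l → M n i j k l * F i j k (suc l))
    sum4-multinom-suc F = *-cancelˡ-≢0 (1-Q^≢0 h n ℕ.≤-refl) (begin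
      c * sum4 (suc n) (λ i j k l → M (suc n) i j k l * F i j k l)
        ≡⟨ sym (sum4-* (suc n) c (λ i j k l → M (suc n) i j k l * F i j k l)) ⟩
      sum4 (suc n) (λ i j k l → c * (M (suc n) i j k l * F i j k l))
        ≡⟨ sum4-cong (suc n) (λ i j k l e → telescope i j k l e (M (suc n) i j k l) (F i j k l)) ⟩
      sum4 (suc n) (λ i j k l → pⱼ i j k l + pᵢ i j k l + pₖ i j k l + pₗ i j k l)
        ≡⟨ trans (sum4-+ (suc n) (λ i j k l → pⱼ i j k l + pᵢ i j k l + pₖ i j k l) pₗ)
             (cong (_+ sum4 (suc n) pₗ) (trans (sum4-+ (suc n) (λ i j k l → pⱼ i j k l + pᵢ i j k l) pₖ)
               (cong (_+ sum4 (suc n) pₖ) (sum4-+ (suc n) pⱼ pᵢ)))) ⟩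
      sum4 (suc n) pⱼ + sum4 (suc n) pᵢ + sum4 (suc n) pₖ + sum4 (suc n) pₗ
        ≡⟨ cong₂ _+_ (cong₂ _+_ (cong₂ _+_ (sum4-multinom-shiftⱼ (λ i j k l → Q ^ (i +ℕ (k +ℕ l)) * F i j k l))
                                           (sum4-multinom-shiftᵢ (λ i j k l → Q ^ l * F i j k l)))
                                (sum4-multinom-shiftₖ (λ i j k l → Q ^ (i +ℕ l) * F i j k l)))
                     (sum4-multinom-shiftₗ F) ⟩
      c * A + c * B + c * C + c * D
        ≡⟨ solve 5 (λ c A B C D → c :* A :+ c :* B :+ c :* C :+ c :* D := c :* (A :+ B :+ C :+ D)) refl c A B C D ⟩
      c * (A + B + C + D) ∎)
      where
      c = 1ℚ - Q ^ suc n
      pⱼ pᵢ pₖ pₗ : ℕ → ℕ → ℕ → ℕ → ℚ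
      pⱼ i j k l = M (suc n) i j k l * ((1ℚ - Q ^ j) * (Q ^ (i +ℕ (k +ℕ l)) * F i j k l))
      pᵢ i j k l = M (suc n) i j k l * ((1ℚ - Q ^ i) * (Q ^ l * F i j k l))
      pₖ i j k l = M (suc n) i j k l * ((1ℚ - Q ^ k) * (Q ^ (i +ℕ l) * F i j k l))
      pₗ i j k l = M (suc n) i j k l * ((1ℚ - Q ^ l) * F i j k l)
      A = sum4 n (λ i j k l → M n i j k l * (Q ^ (i +ℕ (k +ℕ l)) * F i (suc j) k l))
      B = sum4 n (λ i j k l → M n i j k l * (Q ^ l * F (suc i) j k l))
      C = sum4 n (λ i j k l → M n i j k l * (Q ^ (i +ℕ l) * F i j (suc k) l))
      D = sum4 n (λ i j k l → M n i j k l * F i j k (suc l))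
      -- 1 − Q^(i+j+k+l) telescopes through 1 − Q^l, Q^l − Q^(i+l), Q^(i+l) − Q^(i+k+l)
      telescope : ∀ i j k l → i +ℕ (j +ℕ (k +ℕ l)) ≡ suc n → ∀ m f →
        c * (m * f) ≡ m * ((1ℚ - Q ^ j) * (Q ^ (i +ℕ (k +ℕ l)) * f)) + m * ((1ℚ - Q ^ i) * (Q ^ l * f))
                      + m * ((1ℚ - Q ^ k) * (Q ^ (i +ℕ l) * f)) + m * ((1ℚ - Q ^ l) * f)
      telescope i j k l e m f = trans (cong (λ x → (1ℚ - Q ^ x) * (m * f)) (sym e)) (expand i j k l m f)
        where
        expand : ∀ i j k l m f →
          (1ℚ - Q ^ (i +ℕ (j +ℕ (k +ℕ l)))) * (m * f)
            ≡ m * ((1ℚ - Q ^ j) * (Q ^ (i +ℕ (k +ℕ l)) * f)) + m * ((1ℚ - Q ^ i) * (Q ^ l * f))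
              + m * ((1ℚ - Q ^ k) * (Q ^ (i +ℕ l) * f)) + m * ((1ℚ - Q ^ l) * f)
        expand i j k l m f
          rewrite ^-distribˡ-+-* Q i (j +ℕ (k +ℕ l)) | ^-distribˡ-+-* Q j (k +ℕ l)
                | ^-distribˡ-+-* Q i (k +ℕ l) | ^-distribˡ-+-* Q i l | ^-distribˡ-+-* Q k l =
          solve 6 (λ m f a b c d →
              (con 1ℚ :- a :* (b :* (c :* d))) :* (m :* f)
            := m :* ((con 1ℚ :- b) :* (a :* (c :* d) :* f)) :+ m :* ((con 1ℚ :- a) :* (d :* f))
             :+ m :* ((con 1ℚ :- c) :* (a :* d :* f)) :+ m :* ((con 1ℚ :- d) :* f))
            refl m f (Q ^ i) (Q ^ j) (Q ^ k) (Q ^ l)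

module Exponents where
  open import Data.Nat
  import Data.Nat.Properties as ℕ
  open import Data.Nat.Tactic.RingSolver using (solve-∀)
  open import Relation.Binary.PropositionalEquality
  open ≡-Reasoning

  choose2 : ℕ → ℕ
  choose2 zero    = 0
  choose2 (suc n) = n + choose2 n

  -- quad α i = 3i² + (α − 3)i, written without truncated subtraction
  quad : ℕ → ℕ → ℕ
  quad α i = 6 * choose2 i + α * i

  quad-suc : ∀ α i → quad α (suc i) ≡ α + (6 * i + quad α i)
  quad-suc α i = lemma α i (choose2 i)
    where
    lemma : ∀ α i c → 6 * (i + c) + α * suc i ≡ α + (6 * i + (6 * c + α * i))
    lemma = solve-∀

  quad-+ : ∀ α β i → quad (α + β) i ≡ β * i + quad α i
  quad-+ α β i = lemma α β i (choose2 i)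
    where
    lemma : ∀ α β i c → 6 * c + (α + β) * i ≡ β * i + (6 * c + α * i)
    lemma = solve-∀

  3*n*n≡quad3 : ∀ n → 3 * n * n ≡ quad 3 n
  3*n*n≡quad3 zero    = refl
  3*n*n≡quad3 (suc n) = begin
    3 * suc n * suc n       ≡⟨ lemma n ⟩
    3 + (6 * n + 3 * n * n) ≡⟨ cong (λ m → 3 + (6 * n + m)) (3*n*n≡quad3 n) ⟩
    3 + (6 * n + quad 3 n)  ≡⟨ sym (quad-suc 3 n) ⟩
    quad 3 (suc n)          ∎
    where
    lemma : ∀ n → 3 * suc n * suc n ≡ 3 + (6 * n + 3 * n * n)
    lemma = solve-∀

  data Residue : Set where
    one two : Residue

  val : Residue → ℕ
  val one = 1
  val two = 2

  -- the theorem's exponents are 3i² (+ 3μi) − drop a i and 3j² + linear b j, where a and b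
  -- are the residues of the odd- and even-indexed parts that carry a weight
  drop linear : Residue → ℕ → ℕ
  drop one i = 2 * i
  drop two i = i
  linear one j = j
  linear two j = 2 * j

  3i²≡drop+quad : ∀ a i → 3 * i * i ≡ drop a i + quad (val a) i
  3i²≡drop+quad one i = trans (3*n*n≡quad3 i) (quad-+ 1 2 i)
  3i²≡drop+quad two i = trans (3*n*n≡quad3 i) (trans (quad-+ 2 1 i) (cong (_+ quad 2 i) (ℕ.*-identityˡ i)))

  3j²+linear≡quad : ∀ b j → 3 * j * j + linear b j ≡ quad (val b + 3) j
  3j²+linear≡quad one j = trans (cong (_+ j) (3*n*n≡quad3 j))
    (trans (ℕ.+-comm (quad 3 j) j) (sym (trans (quad-+ 3 1 j) (cong (_+ quad 3 j) (ℕ.*-identityˡ j)))))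
  3j²+linear≡quad two j = trans (cong (_+ 2 * j) (3*n*n≡quad3 j))
    (trans (ℕ.+-comm (quad 3 j) (2 * j)) (sym (quad-+ 3 2 j)))

  3i²∸drop≡quad : ∀ a i → 3 * i * i ∸ drop a i ≡ quad (val a) i
  3i²∸drop≡quad a i = trans (cong (_∸ drop a i) (3i²≡drop+quad a i)) (ℕ.m+n∸m≡n (drop a i) _)

  3i²+6i∸drop≡quad : ∀ a i → 3 * i * i + 6 * i ∸ drop a i ≡ quad (val a + 6) i
  3i²+6i∸drop≡quad a i = begin
    3 * i * i + 6 * i ∸ drop a i
      ≡⟨ cong (λ m → m + 6 * i ∸ drop a i) (3i²≡drop+quad a i) ⟩
    drop a i + quad (val a) i + 6 * i ∸ drop a i
      ≡⟨ cong (_∸ drop a i) (ℕ.+-assoc (drop a i) _ _) ⟩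
    drop a i + (quad (val a) i + 6 * i) ∸ drop a i
      ≡⟨ ℕ.m+n∸m≡n (drop a i) _ ⟩
    quad (val a) i + 6 * i
      ≡⟨ ℕ.+-comm (quad (val a) i) (6 * i) ⟩
    6 * i + quad (val a) i
      ≡⟨ sym (quad-+ (val a) 6 i) ⟩
    quad (val a + 6) i ∎

module Partitions where
  open import Defs
  open import Data.Nat using (ℕ; zero; suc; _%_; _≡ᵇ_; _≤_; _<_; s≤s) renaming (_+_ to _+ℕ_; _*_ to _*ℕ_)
  import Data.Nat.Properties as ℕ
  open import Data.Nat.DivMod using ([m+kn]%n≡m%n)
  open import Data.Bool using (Bool; true; false; not; _∧_; _∨_; T)
  open import Data.Bool.Properties using (∧-zeroʳ; ∨-commutativeMonoid)
  open import Algebra.Bundles using (CommutativeMonoid)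
  open import Algebra.Properties.CommutativeSemigroup (CommutativeMonoid.commutativeSemigroup ∨-commutativeMonoid)
    using (x∙yz≈y∙xz)
  open import Data.Bool.ListAction using (any)
  open import Data.List using (List; []; _∷_; _++_; map; filterᵇ)
  open import Data.List.Relation.Unary.All as All using (All; []; _∷_)
  import Data.List.Relation.Unary.All.Properties as All
  open import Data.Rational using (ℚ; 0ℚ; 1ℚ; _+_; _*_)
  open import Data.Rational.Properties using (+-identityˡ; +-identityʳ; +-assoc; *-zeroʳ; *-distribˡ-+)
  open import Function using (_∘_)
  open import Relation.Binary.PropositionalEquality
  open import Relation.Nullary using (yes; no; contradiction)
  open ≡-Reasoning

  ≢⇒≡ᵇ-false : ∀ {m n} → m ≢ n → (m ≡ᵇ n) ≡ false
  ≢⇒≡ᵇ-false {m} {n} m≢n with m ≡ᵇ n in eq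
  ... | false = refl
  ... | true  = contradiction (ℕ.≡ᵇ⇒≡ m n (subst T (sym eq) _)) m≢n

  ≡ᵇ-refl : ∀ n → (n ≡ᵇ n) ≡ true
  ≡ᵇ-refl zero    = refl
  ≡ᵇ-refl (suc n) = ≡ᵇ-refl n

  elemᵇ-above : ∀ {x π} → All (_< x) π → elemᵇ x π ≡ false
  elemᵇ-above []           = refl
  elemᵇ-above (y<x ∷ π<x) = cong₂ _∨_ (≢⇒≡ᵇ-false (λ x≡y → ℕ.<-irrefl (sym x≡y) y<x)) (elemᵇ-above π<x)

  isOne : ℕ → Bool
  isOne p = (p % 3) ≡ᵇ 1

  [r+3N]%3≡r%3 : ∀ r N → (r +ℕ 3 *ℕ N) % 3 ≡ r % 3
  [r+3N]%3≡r%3 r N = trans (cong (λ z → (r +ℕ z) % 3) (ℕ.*-comm 3 N)) ([m+kn]%n≡m%n r N 3)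

  -- noAdjacent12 ρ is definitionally not (any (adjacentIn ρ) ρ)
  adjacentIn : List ℕ → ℕ → Bool
  adjacentIn ρ p = isOne p ∧ elemᵇ (suc p) ρ

  any-adjacentIn-∷ : ∀ m ρ π → any (adjacentIn (suc m ∷ ρ)) π ≡ (isOne m ∧ elemᵇ m π) ∨ any (adjacentIn ρ) π
  any-adjacentIn-∷ m ρ []      = sym (cong (_∨ false) (∧-zeroʳ (isOne m)))
  any-adjacentIn-∷ m ρ (p ∷ π) with p ℕ.≟ m
  ... | no p≢m rewrite ≢⇒≡ᵇ-false p≢m | ≢⇒≡ᵇ-false (p≢m ∘ sym) | any-adjacentIn-∷ m ρ π =
    x∙yz≈y∙xz (isOne p ∧ elemᵇ (suc p) ρ) (isOne m ∧ elemᵇ m π) (any (adjacentIn ρ) π)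
  ... | yes refl rewrite any-adjacentIn-∷ p ρ π | ≡ᵇ-refl p with isOne p
  ...   | true  = refl
  ...   | false = refl

  not-∨ : ∀ a b → not (a ∨ b) ≡ not a ∧ not b
  not-∨ true  b = refl
  not-∨ false b = refl

  noAdjacent12-∷ : ∀ {m π} → All (_≤ m) π →
    noAdjacent12 (suc m ∷ π) ≡ not (isOne m ∧ elemᵇ m π) ∧ noAdjacent12 π
  noAdjacent12-∷ {m} {π} π≤m = begin
    not (adjacentIn (suc m ∷ π) (suc m) ∨ any (adjacentIn (suc m ∷ π)) π)
      ≡⟨ cong₂ (λ a b → not (a ∨ b)) head-isolated (any-adjacentIn-∷ m π π) ⟩
    not ((isOne m ∧ elemᵇ m π) ∨ any (adjacentIn π) π)
      ≡⟨ not-∨ (isOne m ∧ elemᵇ m π) _ ⟩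
    not (isOne m ∧ elemᵇ m π) ∧ noAdjacent12 π ∎
    where
    head-isolated : adjacentIn (suc m ∷ π) (suc m) ≡ false
    head-isolated rewrite ≢⇒≡ᵇ-false {suc m} {m} ℕ.1+n≢n
                        | elemᵇ-above (All.map (λ p≤m → s≤s (ℕ.m≤n⇒m≤1+n p≤m)) π≤m) = ∧-zeroʳ (isOne (suc m))

  distinctParts-≤ : ∀ m → All (All (_≤ m)) (distinctParts m)
  distinctParts-≤ zero    = [] ∷ []
  distinctParts-≤ (suc m) = All.++⁺ (All.map (All.map ℕ.m≤n⇒m≤1+n) (distinctParts-≤ m))
    (All.map⁺ (All.map (λ π≤m → ℕ.≤-refl ∷ All.map ℕ.m≤n⇒m≤1+n π≤m) (distinctParts-≤ m)))

  filteredSum : (List ℕ → Bool) → (List ℕ → ℚ) → List (List ℕ) → ℚ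
  filteredSum p f πs = sumℚ (map f (filterᵇ p πs))

  filteredSum-++ : ∀ p f πs ρs → filteredSum p f (πs ++ ρs) ≡ filteredSum p f πs + filteredSum p f ρs
  filteredSum-++ p f []       ρs = sym (+-identityˡ _)
  filteredSum-++ p f (π ∷ πs) ρs with p π
  ... | true  = trans (cong (f π +_) (filteredSum-++ p f πs ρs)) (sym (+-assoc (f π) _ _))
  ... | false = filteredSum-++ p f πs ρs

  filteredSum-map : ∀ p f g πs → filteredSum p f (map g πs) ≡ filteredSum (p ∘ g) (f ∘ g) πs
  filteredSum-map p f g []       = refl
  filteredSum-map p f g (π ∷ πs) with p (g π)
  ... | true  = cong (f (g π) +_) (filteredSum-map p f g πs)
  ... | false = filteredSum-map p f g πs

  filteredSum-* : ∀ p K f πs → filteredSum p (λ π → K * f π) πs ≡ K * filteredSum p f πs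
  filteredSum-* p K f []       = sym (*-zeroʳ K)
  filteredSum-* p K f (π ∷ πs) with p π
  ... | true  = trans (cong (K * f π +_) (filteredSum-* p K f πs)) (sym (*-distribˡ-+ K (f π) _))
  ... | false = filteredSum-* p K f πs

  filteredSum-cong : ∀ {R : List ℕ → Set} p p′ f f′ πs → All R πs →
    (∀ π → R π → p π ≡ p′ π) → (∀ π → f π ≡ f′ π) → filteredSum p f πs ≡ filteredSum p′ f′ πs
  filteredSum-cong p p′ f f′ []       []          p≡p′ f≡f′ = refl
  filteredSum-cong p p′ f f′ (π ∷ πs) (Rπ ∷ Rπs) p≡p′ f≡f′ with p π | p′ π | p≡p′ π Rπ
  ... | true  | .true  | refl = cong₂ _+_ (f≡f′ π) (filteredSum-cong p p′ f f′ πs Rπs p≡p′ f≡f′)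
  ... | false | .false | refl = filteredSum-cong p p′ f f′ πs Rπs p≡p′ f≡f′

  filteredSum-none : ∀ {R : List ℕ → Set} p f πs → All R πs → (∀ π → R π → p π ≡ false) →
    filteredSum p f πs ≡ 0ℚ
  filteredSum-none p f []       []          p≡false = refl
  filteredSum-none p f (π ∷ πs) (Rπ ∷ Rπs) p≡false with p π | p≡false π Rπ
  ... | false | refl = filteredSum-none p f πs Rπs p≡false

  P-suc : ∀ m s t u v q K → (∀ π → weight s t u v q (suc m ∷ π) ≡ K * weight u v s t q π) →
    P (suc m) s t u v q ≡ P m s t u v q + K * filteredSum (noAdjacent12 ∘ (suc m ∷_)) (weight u v s t q) (distinctParts m)
  P-suc m s t u v q K weight-∷ = begin
    filteredSum noAdjacent12 w (distinctParts m ++ map (suc m ∷_) (distinctParts m))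
      ≡⟨ filteredSum-++ noAdjacent12 w (distinctParts m) (map (suc m ∷_) (distinctParts m)) ⟩
    P m s t u v q + filteredSum noAdjacent12 w (map (suc m ∷_) (distinctParts m))
      ≡⟨ cong (P m s t u v q +_) (begin
           filteredSum noAdjacent12 w (map (suc m ∷_) (distinctParts m))
             ≡⟨ filteredSum-map noAdjacent12 w (suc m ∷_) (distinctParts m) ⟩
           filteredSum p (w ∘ (suc m ∷_)) (distinctParts m)
             ≡⟨ filteredSum-cong p p (w ∘ (suc m ∷_)) (λ π → K * weight u v s t q π) (distinctParts m)
                  (distinctParts-≤ m) (λ _ _ → refl) weight-∷ ⟩
           filteredSum p (λ π → K * weight u v s t q π) (distinctParts m)
             ≡⟨ filteredSum-* p K (weight u v s t q) (distinctParts m) ⟩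
           K * filteredSum p (weight u v s t q) (distinctParts m) ∎) ⟩
    P m s t u v q + K * filteredSum p (weight u v s t q) (distinctParts m) ∎
    where
    w = weight s t u v q
    p = noAdjacent12 ∘ (suc m ∷_)

  P-suc-free : ∀ m s t u v q K → isOne m ≡ false → (∀ π → weight s t u v q (suc m ∷ π) ≡ K * weight u v s t q π) →
    P (suc m) s t u v q ≡ P m s t u v q + K * P m u v s t q
  P-suc-free m s t u v q K m-free weight-∷ = trans (P-suc m s t u v q K weight-∷)
    (cong (λ z → P m s t u v q + K * z)
      (filteredSum-cong _ noAdjacent12 (weight u v s t q) (weight u v s t q) (distinctParts m) (distinctParts-≤ m)
        (λ π π≤m → trans (noAdjacent12-∷ π≤m) (cong (λ b → not (b ∧ elemᵇ m π) ∧ noAdjacent12 π) m-free))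
        (λ _ → refl)))

  -- when suc m ≡ 1 (mod 3), the new part suc (suc m) forbids suc m, so only partitions with parts ≤ m extend
  P-suc-blocked : ∀ m s t u v q K → isOne (suc m) ≡ true →
    (∀ π → weight s t u v q (suc (suc m) ∷ π) ≡ K * weight u v s t q π) →
    P (suc (suc m)) s t u v q ≡ P (suc m) s t u v q + K * P m u v s t q
  P-suc-blocked m s t u v q K 1+m-one weight-∷ = begin
    P (suc (suc m)) s t u v q
      ≡⟨ P-suc (suc m) s t u v q K weight-∷ ⟩
    P (suc m) s t u v q + K * filteredSum p w′ (distinctParts m ++ map (suc m ∷_) (distinctParts m))
      ≡⟨ cong (λ z → P (suc m) s t u v q + K * z) (filteredSum-++ p w′ (distinctParts m) _) ⟩
    P (suc m) s t u v q + K * (filteredSum p w′ (distinctParts m) + filteredSum p w′ (map (suc m ∷_) (distinctParts m)))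
      ≡⟨ cong₂ (λ a b → P (suc m) s t u v q + K * (a + b)) parts≤m containing-1+m ⟩
    P (suc m) s t u v q + K * (P m u v s t q + 0ℚ)
      ≡⟨ cong (λ z → P (suc m) s t u v q + K * z) (+-identityʳ _) ⟩
    P (suc m) s t u v q + K * P m u v s t q ∎
    where
    w′ = weight u v s t q
    p = noAdjacent12 ∘ (suc (suc m) ∷_)
    parts≤m : filteredSum p w′ (distinctParts m) ≡ P m u v s t q
    parts≤m = filteredSum-cong p noAdjacent12 w′ w′ (distinctParts m) (distinctParts-≤ m)
      (λ π π≤m → trans (noAdjacent12-∷ (All.map ℕ.m≤n⇒m≤1+n π≤m))
        (cong₂ (λ a b → not (a ∧ b) ∧ noAdjacent12 π) 1+m-one (elemᵇ-above (All.map s≤s π≤m))))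
      (λ _ → refl)
    containing-1+m : filteredSum p w′ (map (suc m ∷_) (distinctParts m)) ≡ 0ℚ
    containing-1+m = trans (filteredSum-map p w′ (suc m ∷_) (distinctParts m))
      (filteredSum-none (p ∘ (suc m ∷_)) (w′ ∘ (suc m ∷_)) (distinctParts m) (distinctParts-≤ m)
        (λ π π≤m → trans (noAdjacent12-∷ (ℕ.≤-refl ∷ All.map ℕ.m≤n⇒m≤1+n π≤m))
          (cong₂ (λ a b → not (a ∧ (b ∨ elemᵇ (suc m) π)) ∧ noAdjacent12 (suc m ∷ π)) 1+m-one (≡ᵇ-refl m))))

  weight-∷₀ : ∀ s t u v q c π → c % 3 ≡ 0 → weight s t u v q (c ∷ π) ≡ 1ℚ * q ^ c * weight u v s t q π
  weight-∷₀ s t u v q c π c≡0 with c % 3 | c≡0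
  ... | .0 | refl = refl

  weight-∷₁ : ∀ s t u v q c π → c % 3 ≡ 1 → weight s t u v q (c ∷ π) ≡ s * q ^ c * weight u v s t q π
  weight-∷₁ s t u v q c π c≡1 with c % 3 | c≡1
  ... | .1 | refl = refl

  weight-∷₂ : ∀ s t u v q c π → c % 3 ≡ 2 → weight s t u v q (c ∷ π) ≡ t * q ^ c * weight u v s t q π
  weight-∷₂ s t u v q c π c≡2 with c % 3 | c≡2
  ... | .2 | refl = refl

  module _ (N : ℕ) (s t u v q : ℚ) where
    private
      X Y : ℚ
      X = P (3 *ℕ N) s t u v q
      Y = P (3 *ℕ N) u v s t q

    P-3N+1 : P (1 +ℕ 3 *ℕ N) s t u v q ≡ X + s * q ^ (1 +ℕ 3 *ℕ N) * Y
    P-3N+1 = P-suc-free (3 *ℕ N) s t u v q (s * q ^ (1 +ℕ 3 *ℕ N)) (cong (_≡ᵇ 1) ([r+3N]%3≡r%3 0 N))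
      (λ π → weight-∷₁ s t u v q (1 +ℕ 3 *ℕ N) π ([r+3N]%3≡r%3 1 N))

    P-3N+2 : P (2 +ℕ 3 *ℕ N) s t u v q ≡ P (1 +ℕ 3 *ℕ N) s t u v q + t * q ^ (2 +ℕ 3 *ℕ N) * Y
    P-3N+2 = P-suc-blocked (3 *ℕ N) s t u v q (t * q ^ (2 +ℕ 3 *ℕ N)) (cong (_≡ᵇ 1) ([r+3N]%3≡r%3 1 N))
      (λ π → weight-∷₂ s t u v q (2 +ℕ 3 *ℕ N) π ([r+3N]%3≡r%3 2 N))

    P-3N+3 : P (3 +ℕ 3 *ℕ N) s t u v q
           ≡ P (2 +ℕ 3 *ℕ N) s t u v q + 1ℚ * q ^ (3 +ℕ 3 *ℕ N) * P (2 +ℕ 3 *ℕ N) u v s t q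
    P-3N+3 = P-suc-free (2 +ℕ 3 *ℕ N) s t u v q (1ℚ * q ^ (3 +ℕ 3 *ℕ N)) (cong (_≡ᵇ 1) ([r+3N]%3≡r%3 2 N))
      (λ π → weight-∷₀ s t u v q (3 +ℕ 3 *ℕ N) π ([r+3N]%3≡r%3 3 N))

module GeneratingFunction (q : ℚ) where
  open import Defs using (_^_; qMultinom4; sum4)
  open import Data.Nat using (ℕ; zero; suc) renaming (_+_ to _+ℕ_; _*_ to _*ℕ_)
  open import Data.Rational using (ℚ; 1ℚ; _+_; _*_; _-_)
  open import Data.Rational.Solver using (module +-*-Solver)
  open +-*-Solver
  open import Relation.Binary.PropositionalEquality
  open ≡-Reasoning
  import Data.Nat.Tactic.RingSolver as ℕ-Solver
  open RationalArithmetic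
  open SimplexSums
  open Exponents

  Q : ℚ
  Q = q ^ 6

  open QMultinomial Q

  private
    M : ℕ → ℕ → ℕ → ℕ → ℕ → ℚ
    M = qMultinom4 Q

  θ : ℚ → ℕ → ℕ → ℚ
  θ x α i = x ^ i * q ^ quad α i

  θ-suc : ∀ x α i → θ x α (suc i) ≡ x * q ^ α * (Q ^ i * θ x α i)
  θ-suc x α i = begin
    x * x ^ i * q ^ quad α (suc i)
      ≡⟨ cong (λ e → x * x ^ i * q ^ e) (quad-suc α i) ⟩
    x * x ^ i * q ^ (α +ℕ (6 *ℕ i +ℕ quad α i))
      ≡⟨ cong (x * x ^ i *_) (trans (^-distribˡ-+-* q α _) (cong (q ^ α *_) (^-distribˡ-+-* q (6 *ℕ i) _))) ⟩
    x * x ^ i * (q ^ α * (q ^ (6 *ℕ i) * q ^ quad α i))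
      ≡⟨ cong (λ z → x * x ^ i * (q ^ α * (z * q ^ quad α i))) (sym (^-*-assoc q 6 i)) ⟩
    x * x ^ i * (q ^ α * (Q ^ i * q ^ quad α i))
      ≡⟨ solve 5 (λ x xⁱ qᵅ Qⁱ r → x :* xⁱ :* (qᵅ :* (Qⁱ :* r)) := x :* qᵅ :* (Qⁱ :* (xⁱ :* r)))
           refl x (x ^ i) (q ^ α) (Q ^ i) (q ^ quad α i) ⟩
    x * q ^ α * (Q ^ i * θ x α i) ∎

  θ-+ : ∀ x α β i → θ x (α +ℕ β) i ≡ (q ^ β) ^ i * θ x α i
  θ-+ x α β i = begin
    x ^ i * q ^ quad (α +ℕ β) i          ≡⟨ cong (λ e → x ^ i * q ^ e) (quad-+ α β i) ⟩
    x ^ i * q ^ (β *ℕ i +ℕ quad α i)     ≡⟨ cong (x ^ i *_) (^-distribˡ-+-* q (β *ℕ i) _) ⟩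
    x ^ i * (q ^ (β *ℕ i) * q ^ quad α i) ≡⟨ cong (λ z → x ^ i * (z * q ^ quad α i)) (sym (^-*-assoc q β i)) ⟩
    x ^ i * ((q ^ β) ^ i * q ^ quad α i) ≡⟨ solve 3 (λ a b c → a :* (b :* c) := b :* (a :* c)) refl
                                              (x ^ i) ((q ^ β) ^ i) (q ^ quad α i) ⟩
    (q ^ β) ^ i * θ x α i                ∎

  T : ℚ → ℚ → ℕ → ℕ → ℕ → ℕ → ℕ → ℚ
  T x y α β i j k = θ x α i * θ y β j * (q ^ 3) ^ k

  E : ℕ → ℚ → ℚ → ℕ → ℕ → ℚ
  E n x y α β = sum4 n (λ i j k l → M n i j k l * T x y α β i j k)

  W : ℕ → ℚ → ℚ → ℕ → ℕ → ℚ
  W n x y α β = sum4 n (λ i j k l → M n i j k l * (Q ^ (i +ℕ l) * T x y α β i j k))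

  E-suc : ∀ {n} → NoRootOfUnityUpTo (suc n) → ∀ x y α β →
    E (suc n) x y α β ≡ E n x y α β + y * q ^ β * Q ^ n * E n x y α β + (x * q ^ α + q ^ 3) * W n x y α β
  E-suc {n} h x y α β = begin
    E (suc n) x y α β
      ≡⟨ sum4-multinom-suc h (λ i j k _ → T x y α β i j k) ⟩
    Sⱼ + Sᵢ + Sₖ + E n x y α β
      ≡⟨ cong₂ (λ a c → a + c + E n x y α β) (cong₂ _+_ Sⱼ≡ Sᵢ≡) Sₖ≡ ⟩
    y * q ^ β * Q ^ n * E n x y α β + x * q ^ α * W n x y α β + q ^ 3 * W n x y α β + E n x y α β
      ≡⟨ collect (y * q ^ β * Q ^ n) (x * q ^ α) (q ^ 3) (E n x y α β) (W n x y α β) ⟩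
    E n x y α β + y * q ^ β * Q ^ n * E n x y α β + (x * q ^ α + q ^ 3) * W n x y α β ∎
    where
    t = T x y α β
    w = λ k → (q ^ 3) ^ k
    Sⱼ = sum4 n (λ i j k l → M n i j k l * (Q ^ (i +ℕ (k +ℕ l)) * t i (suc j) k))
    Sᵢ = sum4 n (λ i j k l → M n i j k l * (Q ^ l * t (suc i) j k))
    Sₖ = sum4 n (λ i j k l → M n i j k l * (Q ^ (i +ℕ l) * t i j (suc k)))

    collect : ∀ a b c E W → a * E + b * W + c * W + E ≡ E + a * E + (b + c) * W
    collect = solve 5 (λ a b c E W → a :* E :+ b :* W :+ c :* W :+ E := E :+ a :* E :+ (b :+ c) :* W) refl

    Sⱼ≡ : Sⱼ ≡ y * q ^ β * Q ^ n * E n x y α β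
    Sⱼ≡ = trans (sum4-cong n term) (sum4-* n (y * q ^ β * Q ^ n) (λ i j k l → M n i j k l * t i j k))
      where
      rearrange : ∀ m a b u v w c → m * (a * (u * (c * (b * v)) * w)) ≡ c * (a * b) * (m * (u * v * w))
      rearrange = solve 7 (λ m a b u v w c →
        m :* (a :* (u :* (c :* (b :* v)) :* w)) := c :* (a :* b) :* (m :* (u :* v :* w))) refl
      exponent : ∀ i j k l → i +ℕ (k +ℕ l) +ℕ j ≡ i +ℕ (j +ℕ (k +ℕ l))
      exponent = ℕ-Solver.solve-∀
      term : ∀ i j k l → i +ℕ (j +ℕ (k +ℕ l)) ≡ n →
        M n i j k l * (Q ^ (i +ℕ (k +ℕ l)) * t i (suc j) k) ≡ y * q ^ β * Q ^ n * (M n i j k l * t i j k)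
      term i j k l e = begin
        M n i j k l * (Q ^ (i +ℕ (k +ℕ l)) * (θ x α i * θ y β (suc j) * w k))
          ≡⟨ cong (λ z → M n i j k l * (Q ^ (i +ℕ (k +ℕ l)) * (θ x α i * z * w k))) (θ-suc y β j) ⟩
        M n i j k l * (Q ^ (i +ℕ (k +ℕ l)) * (θ x α i * (y * q ^ β * (Q ^ j * θ y β j)) * w k))
          ≡⟨ rearrange (M n i j k l) (Q ^ (i +ℕ (k +ℕ l))) (Q ^ j) (θ x α i) (θ y β j) (w k) (y * q ^ β) ⟩
        y * q ^ β * (Q ^ (i +ℕ (k +ℕ l)) * Q ^ j) * (M n i j k l * t i j k)
          ≡⟨ cong (λ z → y * q ^ β * z * (M n i j k l * t i j k))
               (trans (sym (^-distribˡ-+-* Q (i +ℕ (k +ℕ l)) j)) (cong (Q ^_) (trans (exponent i j k l) e))) ⟩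
        y * q ^ β * Q ^ n * (M n i j k l * t i j k) ∎

    Sᵢ≡ : Sᵢ ≡ x * q ^ α * W n x y α β
    Sᵢ≡ = trans (sum4-cong n λ i j k l _ → term i j k l)
                (sum4-* n (x * q ^ α) (λ i j k l → M n i j k l * (Q ^ (i +ℕ l) * t i j k)))
      where
      rearrange : ∀ m a d u v w c → m * (d * (c * (a * u) * v * w)) ≡ c * (m * (a * d * (u * v * w)))
      rearrange = solve 7 (λ m a d u v w c →
        m :* (d :* (c :* (a :* u) :* v :* w)) := c :* (m :* (a :* d :* (u :* v :* w)))) refl
      term : ∀ i j k l → M n i j k l * (Q ^ l * t (suc i) j k) ≡ x * q ^ α * (M n i j k l * (Q ^ (i +ℕ l) * t i j k))
      term i j k l = begin
        M n i j k l * (Q ^ l * (θ x α (suc i) * θ y β j * w k))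
          ≡⟨ cong (λ z → M n i j k l * (Q ^ l * (z * θ y β j * w k))) (θ-suc x α i) ⟩
        M n i j k l * (Q ^ l * (x * q ^ α * (Q ^ i * θ x α i) * θ y β j * w k))
          ≡⟨ rearrange (M n i j k l) (Q ^ i) (Q ^ l) (θ x α i) (θ y β j) (w k) (x * q ^ α) ⟩
        x * q ^ α * (M n i j k l * (Q ^ i * Q ^ l * t i j k))
          ≡⟨ cong (λ z → x * q ^ α * (M n i j k l * (z * t i j k))) (sym (^-distribˡ-+-* Q i l)) ⟩
        x * q ^ α * (M n i j k l * (Q ^ (i +ℕ l) * t i j k)) ∎

    Sₖ≡ : Sₖ ≡ q ^ 3 * W n x y α β
    Sₖ≡ = trans (sum4-cong n λ i j k l _ → rearrange (M n i j k l) (Q ^ (i +ℕ l)) (θ x α i) (θ y β j) (q ^ 3) (w k))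
                (sum4-* n (q ^ 3) (λ i j k l → M n i j k l * (Q ^ (i +ℕ l) * t i j k)))
      where
      rearrange : ∀ m a u v c w → m * (a * (u * v * (c * w))) ≡ c * (m * (a * (u * v * w)))
      rearrange = solve 6 (λ m a u v c w → m :* (a :* (u :* v :* (c :* w))) := c :* (m :* (a :* (u :* v :* w)))) refl

  Q^≡[q³]^*[q³]^ : ∀ m → Q ^ m ≡ (q ^ 3) ^ m * (q ^ 3) ^ m
  Q^≡[q³]^*[q³]^ m = trans (cong (_^ m) (^-distribˡ-+-* q 3 3)) (^-distribʳ-* (q ^ 3) (q ^ 3) m)

  W≡E-mirror : ∀ n x y α β → W n x y α (β +ℕ 3) ≡ (q ^ 3) ^ n * E n y x β (α +ℕ 3)
  W≡E-mirror n x y α β = begin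
    W n x y α (β +ℕ 3)
      ≡⟨ sum4-mirror n (λ i j k l → Q ^ (i +ℕ l) * T x y α (β +ℕ 3) i j k) ⟩
    sum4 n (λ i j k l → M n i j k l * (Q ^ (j +ℕ k) * T x y α (β +ℕ 3) j i l))
      ≡⟨ sum4-cong n term ⟩
    sum4 n (λ i j k l → c ^ n * (M n i j k l * T y x β (α +ℕ 3) i j k))
      ≡⟨ sum4-* n (c ^ n) (λ i j k l → M n i j k l * T y x β (α +ℕ 3) i j k) ⟩
    c ^ n * E n y x β (α +ℕ 3) ∎
    where
    c = q ^ 3
    c^n≡ : ∀ {i j k l} → i +ℕ (j +ℕ (k +ℕ l)) ≡ n → c ^ n ≡ c ^ i * (c ^ j * (c ^ k * c ^ l))
    c^n≡ {i} {j} {k} {l} refl =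
      trans (^-distribˡ-+-* c i _) (cong (c ^ i *_) (trans (^-distribˡ-+-* c j _) (cong (c ^ j *_) (^-distribˡ-+-* c k l))))
    rearrange : ∀ m a b c d u v → m * (a * a * (b * b) * (u * (d * v) * c)) ≡ d * (a * (b * c)) * (m * (v * (a * u) * b))
    rearrange = solve 7 (λ m a b c d u v →
      m :* (a :* a :* (b :* b) :* (u :* (d :* v) :* c)) := d :* (a :* (b :* c)) :* (m :* (v :* (a :* u) :* b))) refl
    term : ∀ i j k l → i +ℕ (j +ℕ (k +ℕ l)) ≡ n →
      M n i j k l * (Q ^ (j +ℕ k) * T x y α (β +ℕ 3) j i l) ≡ c ^ n * (M n i j k l * T y x β (α +ℕ 3) i j k)
    term i j k l e = begin
      M n i j k l * (Q ^ (j +ℕ k) * (θ x α j * θ y (β +ℕ 3) i * c ^ l))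
        ≡⟨ cong₂ (λ a b → M n i j k l * (a * (θ x α j * b * c ^ l)))
             (trans (^-distribˡ-+-* Q j k) (cong₂ _*_ (Q^≡[q³]^*[q³]^ j) (Q^≡[q³]^*[q³]^ k))) (θ-+ y β 3 i) ⟩
      M n i j k l * (c ^ j * c ^ j * (c ^ k * c ^ k) * (θ x α j * (c ^ i * θ y β i) * c ^ l))
        ≡⟨ rearrange (M n i j k l) (c ^ j) (c ^ k) (c ^ l) (c ^ i) (θ x α j) (θ y β i) ⟩
      c ^ i * (c ^ j * (c ^ k * c ^ l)) * (M n i j k l * (θ y β i * (c ^ j * θ x α j) * c ^ k))
        ≡⟨ cong₂ (λ a b → a * (M n i j k l * (θ y β i * b * c ^ k))) (sym (c^n≡ {i} {j} {k} e)) (sym (θ-+ x α 3 j)) ⟩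
      c ^ n * (M n i j k l * T y x β (α +ℕ 3) i j k) ∎

  E-+6≡ΣQⁱ : ∀ N x y α β → E N x y (α +ℕ 6) β ≡ sum4 N (λ i j k l → M N i j k l * (Q ^ i * T x y α β i j k))
  E-+6≡ΣQⁱ N x y α β = sum4-cong N λ i j k l _ →
    cong (M N i j k l *_) (trans (cong (λ z → z * θ y β j * (q ^ 3) ^ k) (θ-+ x α 6 i))
      (rearrange (Q ^ i) (θ x α i) (θ y β j) ((q ^ 3) ^ k)))
    where
    rearrange : ∀ a u v w → a * u * v * w ≡ a * (u * v * w)
    rearrange = solve 4 (λ a u v w → a :* u :* v :* w := a :* (u :* v :* w)) refl

  E-+6 : ∀ {N} → NoRootOfUnityUpTo N → ∀ x y α β →
    (1ℚ + x * q ^ α) * E N x y (α +ℕ 6) β ≡ E N x y α β + x * q ^ α * W N x y α β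
  E-+6 {zero} h x y α β =
    trans (cong ((1ℚ + x * q ^ α) *_) (E-+6≡ΣQⁱ 0 x y α β)) (base (x * q ^ α) (M 0 0 0 0 0) (T x y α β 0 0 0))
    where
    base : ∀ a m t → (1ℚ + a) * (m * (1ℚ * t)) ≡ m * t + a * (m * (1ℚ * t))
    base = solve 3 (λ a m t → (con 1ℚ :+ a) :* (m :* (con 1ℚ :* t)) := m :* t :+ a :* (m :* (con 1ℚ :* t))) refl
  E-+6 {suc n} h x y α β = begin
    (1ℚ + a) * E (suc n) x y (α +ℕ 6) β ≡⟨ cong ((1ℚ + a) *_) (trans (E-+6≡ΣQⁱ (suc n) x y α β) V≡W+cZ) ⟩
    (1ℚ + a) * (W′ + c * Z)             ≡⟨ expand a W′ c Z ⟩
    W′ + c * Z + c * (a * Z) + a * W′   ≡⟨ cong (λ v → v + c * (a * Z) + a * W′) (sym V≡W+cZ) ⟩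
    V + c * (a * Z) + a * W′            ≡⟨ cong (_+ a * W′) (sym E≡V+caZ) ⟩
    E (suc n) x y α β + a * W′          ∎
    where
    a = x * q ^ α
    c = 1ℚ - Q ^ suc n
    t = T x y α β
    W′ = W (suc n) x y α β
    V = sum4 (suc n) (λ i j k l → M (suc n) i j k l * (Q ^ i * t i j k))
    Z = sum4 n (λ i j k l → M n i j k l * (Q ^ i * t i j k))

    expand : ∀ a W c Z → (1ℚ + a) * (W + c * Z) ≡ W + c * Z + c * (a * Z) + a * W
    expand = solve 4 (λ a W c Z → (con 1ℚ :+ a) :* (W :+ c :* Z) := W :+ c :* Z :+ c :* (a :* Z) :+ a :* W) refl
    split : ∀ m a b t {ab} → ab ≡ a * b → m * (a * t) ≡ m * (ab * t) + m * ((1ℚ - b) * (a * t))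
    split m a b t refl =
      solve 4 (λ m a b t → m :* (a :* t) := m :* (a :* b :* t) :+ m :* ((con 1ℚ :- b) :* (a :* t))) refl m a b t

    V≡W+cZ : V ≡ W′ + c * Z
    V≡W+cZ = begin
      V ≡⟨ sum4-cong (suc n) (λ i j k l _ → split (M (suc n) i j k l) (Q ^ i) (Q ^ l) (t i j k) (^-distribˡ-+-* Q i l)) ⟩
      sum4 (suc n) (λ i j k l → M (suc n) i j k l * (Q ^ (i +ℕ l) * t i j k)
                                + M (suc n) i j k l * ((1ℚ - Q ^ l) * (Q ^ i * t i j k)))
        ≡⟨ sum4-+ (suc n) (λ i j k l → M (suc n) i j k l * (Q ^ (i +ℕ l) * t i j k))
                          (λ i j k l → M (suc n) i j k l * ((1ℚ - Q ^ l) * (Q ^ i * t i j k))) ⟩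
      W′ + sum4 (suc n) (λ i j k l → M (suc n) i j k l * ((1ℚ - Q ^ l) * (Q ^ i * t i j k)))
        ≡⟨ cong (W′ +_) (sum4-multinom-shiftₗ h (λ i j k _ → Q ^ i * t i j k)) ⟩
      W′ + c * Z ∎

    E≡V+caZ : E (suc n) x y α β ≡ V + c * (a * Z)
    E≡V+caZ = begin
      E (suc n) x y α β
        ≡⟨ sum4-cong (suc n) (λ i j k l _ → split′ (M (suc n) i j k l) (Q ^ i) (t i j k)) ⟩
      sum4 (suc n) (λ i j k l → M (suc n) i j k l * (Q ^ i * t i j k) + M (suc n) i j k l * ((1ℚ - Q ^ i) * t i j k))
        ≡⟨ sum4-+ (suc n) (λ i j k l → M (suc n) i j k l * (Q ^ i * t i j k))
                          (λ i j k l → M (suc n) i j k l * ((1ℚ - Q ^ i) * t i j k)) ⟩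
      V + sum4 (suc n) (λ i j k l → M (suc n) i j k l * ((1ℚ - Q ^ i) * t i j k))
        ≡⟨ cong (V +_) (sum4-multinom-shiftᵢ h (λ i j k _ → t i j k)) ⟩
      V + c * sum4 n (λ i j k l → M n i j k l * t (suc i) j k)
        ≡⟨ cong (λ z → V + c * z) (trans (sum4-cong n λ i j k l _ → shiftedᵢ (M n i j k l) i j k)
                                         (sum4-* n a (λ i j k l → M n i j k l * (Q ^ i * t i j k)))) ⟩
      V + c * (a * Z) ∎
      where
      split′ : ∀ m b t → m * t ≡ m * (b * t) + m * ((1ℚ - b) * t)
      split′ = solve 3 (λ m b t → m :* t := m :* (b :* t) :+ m :* ((con 1ℚ :- b) :* t)) refl
      rearrange : ∀ m a b u v w → m * (a * (b * u) * v * w) ≡ a * (m * (b * (u * v * w)))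
      rearrange = solve 6 (λ m a b u v w → m :* (a :* (b :* u) :* v :* w) := a :* (m :* (b :* (u :* v :* w)))) refl
      shiftedᵢ : ∀ m i j k → m * t (suc i) j k ≡ a * (m * (Q ^ i * t i j k))
      shiftedᵢ m i j k = trans (cong (λ z → m * (z * θ y β j * (q ^ 3) ^ k)) (θ-suc x α i))
                               (rearrange m a (Q ^ i) (θ x α i) (θ y β j) ((q ^ 3) ^ k))

  T≡power : ∀ x y α β i j k → T x y α β i j k ≡ x ^ i * y ^ j * q ^ (quad α i +ℕ quad β j +ℕ 3 *ℕ k)
  T≡power x y α β i j k = begin
    x ^ i * q ^ quad α i * (y ^ j * q ^ quad β j) * (q ^ 3) ^ k
      ≡⟨ cong (x ^ i * q ^ quad α i * (y ^ j * q ^ quad β j) *_) (^-*-assoc q 3 k) ⟩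
    x ^ i * q ^ quad α i * (y ^ j * q ^ quad β j) * q ^ (3 *ℕ k)
      ≡⟨ regroup (x ^ i) (y ^ j) (q ^ quad α i) (q ^ quad β j) (q ^ (3 *ℕ k)) ⟩
    x ^ i * y ^ j * (q ^ quad α i * q ^ quad β j * q ^ (3 *ℕ k))
      ≡⟨ cong (x ^ i * y ^ j *_) (sym (trans (^-distribˡ-+-* q (quad α i +ℕ quad β j) (3 *ℕ k))
                                            (cong (_* q ^ (3 *ℕ k)) (^-distribˡ-+-* q (quad α i) (quad β j))))) ⟩
    x ^ i * y ^ j * q ^ (quad α i +ℕ quad β j +ℕ 3 *ℕ k) ∎
    where
    regroup : ∀ a b u v w → a * u * (b * v) * w ≡ a * b * (u * v * w)
    regroup = solve 5 (λ a b u v w → a :* u :* (b :* v) :* w := a :* b :* (u :* v :* w)) refl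

module ColouredPartitions (q : ℚ) where
  open import Defs using (_^_; P; qMultinom4; sum4)
  open import Data.Nat using (ℕ; zero; suc; _∸_; _≤_) renaming (_+_ to _+ℕ_; _*_ to _*ℕ_)
  import Data.Nat.Properties as ℕ
  open import Data.Nat.Tactic.RingSolver using (solve-∀)
  import Data.Integer as ℤ
  open import Data.Rational using (ℚ; 0ℚ; 1ℚ; _+_; _*_; _/_)
  open import Data.Rational.Properties using (*-assoc; *-identityˡ; *-identityʳ)
  open import Data.Rational.Solver using (module +-*-Solver)
  open +-*-Solver
  open import Data.Sum using (_⊎_; inj₁; inj₂)
  open import Relation.Binary.PropositionalEquality
  open ≡-Reasoning
  open RationalArithmetic
  open SimplexSums
  open Exponents
  open Partitions
  open GeneratingFunction q
  open QMultinomial Q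

  on₁ on₂ : Residue → ℚ → ℚ
  on₁ one x = x
  on₁ two _ = 0ℚ
  on₂ one _ = 0ℚ
  on₂ two x = x

  -- Pᶜ M a x b y weights the odd-indexed parts ≡ val a and the even-indexed parts ≡ val b (mod 3)
  -- by x and y and all other parts ≢ 0 (mod 3) by 0; e.g. P_M(0,t,u,0) = Pᶜ M two t one u.
  Pᶜ : ℕ → Residue → ℚ → Residue → ℚ → ℚ
  Pᶜ M a x b y = P M (on₁ a x) (on₂ a x) (on₁ b y) (on₂ b y) q

  Pᶜ-3N+2 : ∀ N a x b y →
    Pᶜ (2 +ℕ 3 *ℕ N) a x b y ≡ Pᶜ (3 *ℕ N) a x b y + x * q ^ val a * q ^ (3 *ℕ N) * Pᶜ (3 *ℕ N) b y a x
  Pᶜ-3N+2 N a x b y = begin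
    Pᶜ (2 +ℕ 3 *ℕ N) a x b y
      ≡⟨ P-3N+2 N s t u v q ⟩
    Pᶜ (1 +ℕ 3 *ℕ N) a x b y + t * q ^ (2 +ℕ 3 *ℕ N) * Y
      ≡⟨ cong (_+ t * q ^ (2 +ℕ 3 *ℕ N) * Y) (P-3N+1 N s t u v q) ⟩
    X + s * (q * R) * Y + t * (q * (q * R)) * Y
      ≡⟨ factor X Y s t (q * R) (q * (q * R)) ⟩
    X + (s * (q * R) + t * (q * (q * R))) * Y
      ≡⟨ cong (λ z → X + z * Y) (weights a) ⟩
    X + x * q ^ val a * R * Y ∎
    where
    s = on₁ a x
    t = on₂ a x
    u = on₁ b y
    v = on₂ b y
    R = q ^ (3 *ℕ N)
    X = Pᶜ (3 *ℕ N) a x b y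
    Y = Pᶜ (3 *ℕ N) b y a x
    factor : ∀ X Y s t a b → X + s * a * Y + t * b * Y ≡ X + (s * a + t * b) * Y
    factor = solve 6 (λ X Y s t a b → X :+ s :* a :* Y :+ t :* b :* Y := X :+ (s :* a :+ t :* b) :* Y) refl
    weights : ∀ a → on₁ a x * (q * R) + on₂ a x * (q * (q * R)) ≡ x * q ^ val a * R
    weights one = solve 3 (λ x q R → x :* (q :* R) :+ con 0ℚ :* (q :* (q :* R)) := x :* (q :* con 1ℚ) :* R) refl x q R
    weights two = solve 3 (λ x q R → con 0ℚ :* (q :* R) :+ x :* (q :* (q :* R)) := x :* (q :* (q :* con 1ℚ)) :* R) refl x q R

  P-3N : ∀ n → NoRootOfUnityUpTo n → ∀ a x b y → Pᶜ (3 *ℕ n) a x b y ≡ E n x y (val a) (val b +ℕ 3)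
  P-3N zero    h one x one y = refl
  P-3N zero    h one x two y = refl
  P-3N zero    h two x one y = refl
  P-3N zero    h two x two y = refl
  P-3N (suc n) h a x b y = begin
    Pᶜ (3 *ℕ suc n) a x b y
      ≡⟨ cong (λ m → Pᶜ m a x b y) (ℕ.*-suc 3 n) ⟩
    Pᶜ (3 +ℕ 3 *ℕ n) a x b y
      ≡⟨ P-3N+3 n (on₁ a x) (on₂ a x) (on₁ b y) (on₂ b y) q ⟩
    Pᶜ (2 +ℕ 3 *ℕ n) a x b y + 1ℚ * (q * (q * (q * R′))) * Pᶜ (2 +ℕ 3 *ℕ n) b y a x
      ≡⟨ cong₂ (λ u v → u + 1ℚ * (q * (q * (q * R′))) * v) (Pᶜ-3N+2 n a x b y) (Pᶜ-3N+2 n b y a x) ⟩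
    X + x * q ^ val a * R′ * Y + 1ℚ * (q * (q * (q * R′))) * (Y + y * q ^ val b * R′ * X)
      ≡⟨ cong₂ (λ u v → u + x * q ^ val a * R′ * v + 1ℚ * (q * (q * (q * R′))) * (v + y * q ^ val b * R′ * u))
           (P-3N n (weaken h) a x b y) (P-3N n (weaken h) b y a x) ⟩
    E₁ + x * q ^ val a * R′ * E₂ + 1ℚ * (q * (q * (q * R′))) * (E₂ + y * q ^ val b * R′ * E₁)
      ≡⟨ cong (λ r → E₁ + x * q ^ val a * r * E₂ + 1ℚ * (q * (q * (q * r))) * (E₂ + y * q ^ val b * r * E₁))
           (sym (^-*-assoc q 3 n)) ⟩
    E₁ + x * q ^ val a * R * E₂ + 1ℚ * (q * (q * (q * R))) * (E₂ + y * q ^ val b * R * E₁)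
      ≡⟨ regroup E₁ E₂ x y (q ^ val a) (q ^ val b) q R ⟩
    E₁ + y * (q ^ val b * q ^ 3) * (R * R) * E₁ + (x * q ^ val a + q ^ 3) * (R * E₂)
      ≡⟨ cong₂ (λ c w → E₁ + c * E₁ + (x * q ^ val a + q ^ 3) * w)
           (cong₂ (λ qᵝ Qⁿ → y * qᵝ * Qⁿ) (sym (^-distribˡ-+-* q (val b) 3)) (sym (Q^≡[q³]^*[q³]^ n)))
           (sym (W≡E-mirror n x y (val a) (val b))) ⟩
    E₁ + y * q ^ (val b +ℕ 3) * Q ^ n * E₁ + (x * q ^ val a + q ^ 3) * W n x y (val a) (val b +ℕ 3)
      ≡⟨ sym (E-suc h x y (val a) (val b +ℕ 3)) ⟩
    E (suc n) x y (val a) (val b +ℕ 3) ∎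
    where
    R′ = q ^ (3 *ℕ n)
    R = (q ^ 3) ^ n
    X = Pᶜ (3 *ℕ n) a x b y
    Y = Pᶜ (3 *ℕ n) b y a x
    E₁ = E n x y (val a) (val b +ℕ 3)
    E₂ = E n y x (val b) (val a +ℕ 3)
    weaken : ∀ {n} → NoRootOfUnityUpTo (suc n) → NoRootOfUnityUpTo n
    weaken h m 1≤m m≤n = h m 1≤m (ℕ.m≤n⇒m≤1+n m≤n)
    regroup : ∀ E₁ E₂ x y a b q R →
      E₁ + x * a * R * E₂ + 1ℚ * (q * (q * (q * R))) * (E₂ + y * b * R * E₁)
        ≡ E₁ + y * (b * (q * (q * (q * 1ℚ)))) * (R * R) * E₁ + (x * a + q * (q * (q * 1ℚ))) * (R * E₂)
    regroup = solve 8 (λ E₁ E₂ x y a b q R →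
        E₁ :+ x :* a :* R :* E₂ :+ con 1ℚ :* (q :* (q :* (q :* R))) :* (E₂ :+ y :* b :* R :* E₁)
      := E₁ :+ y :* (b :* (q :* (q :* (q :* con 1ℚ)))) :* (R :* R) :* E₁ :+ (x :* a :+ q :* (q :* (q :* con 1ℚ))) :* (R :* E₂))
      refl

  qᶜ : Residue → ℚ
  qᶜ one = q
  qᶜ two = q ^ 2

  q^val≡qᶜ : ∀ a → q ^ val a ≡ qᶜ a
  q^val≡qᶜ one = *-identityʳ q
  q^val≡qᶜ two = refl

  sum-of-powers≡E : ∀ N x y α β (e : ℕ → ℕ → ℕ → ℕ) →
    (∀ i j k → e i j k ≡ quad α i +ℕ quad β j +ℕ 3 *ℕ k) →
    sum4 N (λ i j k l → qMultinom4 Q N i j k l * x ^ i * y ^ j * q ^ e i j k) ≡ E N x y α β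
  sum-of-powers≡E N x y α β e e≡ = sum4-cong N λ i j k l _ → begin
    qMultinom4 Q N i j k l * x ^ i * y ^ j * q ^ e i j k
      ≡⟨ assoc (qMultinom4 Q N i j k l) (x ^ i) (y ^ j) (q ^ e i j k) ⟩
    qMultinom4 Q N i j k l * (x ^ i * y ^ j * q ^ e i j k)
      ≡⟨ cong (λ z → qMultinom4 Q N i j k l * (x ^ i * y ^ j * q ^ z)) (e≡ i j k) ⟩
    qMultinom4 Q N i j k l * (x ^ i * y ^ j * q ^ (quad α i +ℕ quad β j +ℕ 3 *ℕ k))
      ≡⟨ cong (qMultinom4 Q N i j k l *_) (sym (T≡power x y α β i j k)) ⟩
    qMultinom4 Q N i j k l * T x y α β i j k ∎
    where
    assoc : ∀ m a b c → m * a * b * c ≡ m * (a * b * c)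
    assoc = solve 4 (λ m a b c → m :* a :* b :* c := m :* (a :* b :* c)) refl

  module _ (N : ℕ) (h : NoRootOfUnityUpTo N) where

    P-3N+μ : ∀ μ → μ ≡ 0 ⊎ μ ≡ 2 → ∀ a x b y →
      Pᶜ (3 *ℕ N +ℕ μ) a x b y ≡ (1ℚ + ((ℤ.+ μ) / 2) * x * qᶜ a) *
        sum4 N (λ i j k l → qMultinom4 (q ^ 6) N i j k l * x ^ i * y ^ j
          * q ^ ((3 *ℕ i *ℕ i +ℕ 3 *ℕ μ *ℕ i ∸ drop a i) +ℕ 3 *ℕ j *ℕ j +ℕ linear b j +ℕ 3 *ℕ k))
    P-3N+μ .0 (inj₁ refl) a x b y = begin
      Pᶜ (3 *ℕ N +ℕ 0) a x b y           ≡⟨ cong (λ m → Pᶜ m a x b y) (ℕ.+-identityʳ (3 *ℕ N)) ⟩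
      Pᶜ (3 *ℕ N) a x b y                ≡⟨ P-3N N h a x b y ⟩
      E N x y (val a) (val b +ℕ 3)       ≡⟨ sym (sum-of-powers≡E N x y (val a) (val b +ℕ 3) _ exponent) ⟩
      S                                  ≡⟨ unit x (qᶜ a) S ⟩
      (1ℚ + 0ℚ * x * qᶜ a) * S           ∎
      where
      S = sum4 N (λ i j k l → qMultinom4 (q ^ 6) N i j k l * x ^ i * y ^ j
            * q ^ ((3 *ℕ i *ℕ i +ℕ 0 ∸ drop a i) +ℕ 3 *ℕ j *ℕ j +ℕ linear b j +ℕ 3 *ℕ k))
      unit : ∀ x c S → S ≡ (1ℚ + 0ℚ * x * c) * S
      unit = solve 3 (λ x c S → S := (con 1ℚ :+ con 0ℚ :* x :* c) :* S) refl
      exponent : ∀ i j k → (3 *ℕ i *ℕ i +ℕ 0 ∸ drop a i) +ℕ 3 *ℕ j *ℕ j +ℕ linear b j +ℕ 3 *ℕ k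
                           ≡ quad (val a) i +ℕ quad (val b +ℕ 3) j +ℕ 3 *ℕ k
      exponent i j k = cong (_+ℕ 3 *ℕ k) (trans (ℕ.+-assoc (3 *ℕ i *ℕ i +ℕ 0 ∸ drop a i) _ _)
        (cong₂ _+ℕ_ (trans (cong (_∸ drop a i) (ℕ.+-identityʳ _)) (3i²∸drop≡quad a i)) (3j²+linear≡quad b j)))
    P-3N+μ .2 (inj₂ refl) a x b y = begin
      Pᶜ (3 *ℕ N +ℕ 2) a x b y
        ≡⟨ cong (λ m → Pᶜ m a x b y) (ℕ.+-comm (3 *ℕ N) 2) ⟩
      Pᶜ (2 +ℕ 3 *ℕ N) a x b y
        ≡⟨ Pᶜ-3N+2 N a x b y ⟩
      Pᶜ (3 *ℕ N) a x b y + x * q ^ val a * q ^ (3 *ℕ N) * Pᶜ (3 *ℕ N) b y a x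
        ≡⟨ cong₂ (λ u v → u + x * q ^ val a * q ^ (3 *ℕ N) * v) (P-3N N h a x b y) (P-3N N h b y a x) ⟩
      E₁ + x * q ^ val a * q ^ (3 *ℕ N) * E₂
        ≡⟨ cong (E₁ +_) (trans (cong (λ r → x * q ^ val a * r * E₂) (sym (^-*-assoc q 3 N)))
                               (*-assoc (x * q ^ val a) ((q ^ 3) ^ N) E₂)) ⟩
      E₁ + x * q ^ val a * ((q ^ 3) ^ N * E₂)
        ≡⟨ cong (λ w → E₁ + x * q ^ val a * w) (sym (W≡E-mirror N x y (val a) (val b))) ⟩
      E₁ + x * q ^ val a * W N x y (val a) (val b +ℕ 3)
        ≡⟨ sym (E-+6 h x y (val a) (val b +ℕ 3)) ⟩
      (1ℚ + x * q ^ val a) * E N x y (val a +ℕ 6) (val b +ℕ 3)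
        ≡⟨ cong₂ (λ c S → (1ℚ + c) * S) (trans (cong (x *_) (q^val≡qᶜ a)) (sym (*-identityˡ-assoc x (qᶜ a))))
                                       (sym (sum-of-powers≡E N x y (val a +ℕ 6) (val b +ℕ 3) _ exponent)) ⟩
      (1ℚ + 1ℚ * x * qᶜ a) * sum4 N (λ i j k l → qMultinom4 (q ^ 6) N i j k l * x ^ i * y ^ j
          * q ^ ((3 *ℕ i *ℕ i +ℕ 6 *ℕ i ∸ drop a i) +ℕ 3 *ℕ j *ℕ j +ℕ linear b j +ℕ 3 *ℕ k)) ∎
      where
      E₁ = E N x y (val a) (val b +ℕ 3)
      E₂ = E N y x (val b) (val a +ℕ 3)
      *-identityˡ-assoc : ∀ x c → 1ℚ * x * c ≡ x * c
      *-identityˡ-assoc x c = cong (_* c) (*-identityˡ x)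
      exponent : ∀ i j k → (3 *ℕ i *ℕ i +ℕ 6 *ℕ i ∸ drop a i) +ℕ 3 *ℕ j *ℕ j +ℕ linear b j +ℕ 3 *ℕ k
                           ≡ quad (val a +ℕ 6) i +ℕ quad (val b +ℕ 3) j +ℕ 3 *ℕ k
      exponent i j k = cong (_+ℕ 3 *ℕ k) (trans (ℕ.+-assoc (3 *ℕ i *ℕ i +ℕ 6 *ℕ i ∸ drop a i) _ _)
        (cong₂ _+ℕ_ (3i²+6i∸drop≡quad a i) (3j²+linear≡quad b j)))

    P-3N+1-two : ∀ b x y → Pᶜ (3 *ℕ N +ℕ 1) two x b y ≡
      sum4 N (λ i j k l → qMultinom4 (q ^ 6) N i j k l * x ^ i * y ^ j
        * q ^ ((3 *ℕ i *ℕ i ∸ i) +ℕ 3 *ℕ j *ℕ j +ℕ linear b j +ℕ 3 *ℕ k))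
    P-3N+1-two b x y = begin
      Pᶜ (3 *ℕ N +ℕ 1) two x b y
        ≡⟨ cong (λ m → Pᶜ m two x b y) (ℕ.+-comm (3 *ℕ N) 1) ⟩
      Pᶜ (1 +ℕ 3 *ℕ N) two x b y
        ≡⟨ P-3N+1 N 0ℚ x (on₁ b y) (on₂ b y) q ⟩
      Pᶜ (3 *ℕ N) two x b y + 0ℚ * q ^ (1 +ℕ 3 *ℕ N) * Pᶜ (3 *ℕ N) b y two x
        ≡⟨ no-second-term (Pᶜ (3 *ℕ N) two x b y) (q ^ (1 +ℕ 3 *ℕ N)) (Pᶜ (3 *ℕ N) b y two x) ⟩
      Pᶜ (3 *ℕ N) two x b y
        ≡⟨ P-3N N h two x b y ⟩
      E N x y 2 (val b +ℕ 3)
        ≡⟨ sym (sum-of-powers≡E N x y 2 (val b +ℕ 3) _ λ i j k →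
             cong (_+ℕ 3 *ℕ k) (trans (ℕ.+-assoc (3 *ℕ i *ℕ i ∸ i) _ _)
               (cong₂ _+ℕ_ (3i²∸drop≡quad two i) (3j²+linear≡quad b j)))) ⟩
      sum4 N (λ i j k l → qMultinom4 (q ^ 6) N i j k l * x ^ i * y ^ j
        * q ^ ((3 *ℕ i *ℕ i ∸ i) +ℕ 3 *ℕ j *ℕ j +ℕ linear b j +ℕ 3 *ℕ k)) ∎
      where
      no-second-term : ∀ X c Y → X + 0ℚ * c * Y ≡ X
      no-second-term = solve 3 (λ X c Y → X :+ con 0ℚ :* c :* Y := X) refl

    P-3N+1-one : ∀ b x y (D : ℕ → ℕ → ℕ) →
      (∀ i j k l → i +ℕ (j +ℕ (k +ℕ l)) ≡ N →
        quad 1 i +ℕ quad (val b +ℕ 3) j +ℕ 3 *ℕ k +ℕ D i j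
          ≡ 1 +ℕ 3 *ℕ N +ℕ (quad (val b) i +ℕ quad 4 j +ℕ 3 *ℕ k)) →
      Pᶜ (3 *ℕ N +ℕ 1) one x b y ≡
        sum4 N (λ i j k l → qMultinom4 (q ^ 6) N i j k l
          * q ^ ((3 *ℕ i *ℕ i ∸ 2 *ℕ i) +ℕ 3 *ℕ j *ℕ j +ℕ linear b j +ℕ 3 *ℕ k)
          * (x ^ i * y ^ j + x ^ suc j * y ^ i * q ^ D i j))
    P-3N+1-one b x y D D-shifts = begin
      Pᶜ (3 *ℕ N +ℕ 1) one x b y
        ≡⟨ cong (λ m → Pᶜ m one x b y) (ℕ.+-comm (3 *ℕ N) 1) ⟩
      Pᶜ (1 +ℕ 3 *ℕ N) one x b y
        ≡⟨ P-3N+1 N x 0ℚ (on₁ b y) (on₂ b y) q ⟩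
      Pᶜ (3 *ℕ N) one x b y + x * q ^ (1 +ℕ 3 *ℕ N) * Pᶜ (3 *ℕ N) b y one x
        ≡⟨ cong₂ (λ u v → u + x * q ^ (1 +ℕ 3 *ℕ N) * v) (P-3N N h one x b y) (P-3N N h b y one x) ⟩
      E N x y 1 (val b +ℕ 3) + x * q ^ (1 +ℕ 3 *ℕ N) * E N y x (val b) 4
        ≡⟨ sym (sum4-split N _ (λ i j k l → qMultinom4 Q N i j k l * T x y 1 (val b +ℕ 3) i j k)
                               (λ i j k l → qMultinom4 Q N i j k l * T y x (val b) 4 i j k)
                               (x * q ^ (1 +ℕ 3 *ℕ N)) term) ⟩
      sum4 N (λ i j k l → qMultinom4 (q ^ 6) N i j k l
          * q ^ ((3 *ℕ i *ℕ i ∸ 2 *ℕ i) +ℕ 3 *ℕ j *ℕ j +ℕ linear b j +ℕ 3 *ℕ k)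
          * (x ^ i * y ^ j + x ^ suc j * y ^ i * q ^ D i j)) ∎
      where
      expand : ∀ m e x xⁱ xʲ yⁱ yʲ d →
        m * e * (xⁱ * yʲ + x * xʲ * yⁱ * d) ≡ m * (xⁱ * yʲ * e) + x * (e * d) * (m * (yⁱ * xʲ))
      expand = solve 8 (λ m e x xⁱ xʲ yⁱ yʲ d →
        m :* e :* (xⁱ :* yʲ :+ x :* xʲ :* yⁱ :* d) := m :* (xⁱ :* yʲ :* e) :+ x :* (e :* d) :* (m :* (yⁱ :* xʲ))) refl
      regroup : ∀ m x c e′ xʲ yⁱ → x * (c * e′) * (m * (yⁱ * xʲ)) ≡ x * c * (m * (yⁱ * xʲ * e′))
      regroup = solve 6 (λ m x c e′ xʲ yⁱ →
        x :* (c :* e′) :* (m :* (yⁱ :* xʲ)) := x :* c :* (m :* (yⁱ :* xʲ :* e′))) refl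
      term : ∀ i j k l → i +ℕ (j +ℕ (k +ℕ l)) ≡ N →
        qMultinom4 Q N i j k l * q ^ ((3 *ℕ i *ℕ i ∸ 2 *ℕ i) +ℕ 3 *ℕ j *ℕ j +ℕ linear b j +ℕ 3 *ℕ k)
          * (x ^ i * y ^ j + x ^ suc j * y ^ i * q ^ D i j)
        ≡ qMultinom4 Q N i j k l * T x y 1 (val b +ℕ 3) i j k
          + x * q ^ (1 +ℕ 3 *ℕ N) * (qMultinom4 Q N i j k l * T y x (val b) 4 i j k)
      term i j k l e = begin
        m * q ^ e₁′ * (x ^ i * y ^ j + x * x ^ j * y ^ i * q ^ D i j)
          ≡⟨ cong (λ z → m * q ^ z * (x ^ i * y ^ j + x * x ^ j * y ^ i * q ^ D i j)) e₁′≡e₁ ⟩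
        m * q ^ e₁ * (x ^ i * y ^ j + x * x ^ j * y ^ i * q ^ D i j)
          ≡⟨ expand m (q ^ e₁) x (x ^ i) (x ^ j) (y ^ i) (y ^ j) (q ^ D i j) ⟩
        m * (x ^ i * y ^ j * q ^ e₁) + x * (q ^ e₁ * q ^ D i j) * (m * (y ^ i * x ^ j))
          ≡⟨ cong₂ (λ u v → m * u + x * v * (m * (y ^ i * x ^ j)))
               (sym (T≡power x y 1 (val b +ℕ 3) i j k))
               (trans (sym (^-distribˡ-+-* q e₁ (D i j)))
                 (trans (cong (q ^_) (D-shifts i j k l e)) (^-distribˡ-+-* q (1 +ℕ 3 *ℕ N) e₂))) ⟩
        m * T x y 1 (val b +ℕ 3) i j k + x * (q ^ (1 +ℕ 3 *ℕ N) * q ^ e₂) * (m * (y ^ i * x ^ j))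
          ≡⟨ cong (m * T x y 1 (val b +ℕ 3) i j k +_)
               (trans (regroup m x (q ^ (1 +ℕ 3 *ℕ N)) (q ^ e₂) (x ^ j) (y ^ i))
                      (cong (λ z → x * q ^ (1 +ℕ 3 *ℕ N) * (m * z)) (sym (T≡power y x (val b) 4 i j k)))) ⟩
        m * T x y 1 (val b +ℕ 3) i j k + x * q ^ (1 +ℕ 3 *ℕ N) * (m * T y x (val b) 4 i j k) ∎
        where
        m = qMultinom4 Q N i j k l
        e₁′ = (3 *ℕ i *ℕ i ∸ 2 *ℕ i) +ℕ 3 *ℕ j *ℕ j +ℕ linear b j +ℕ 3 *ℕ k
        e₁ = quad 1 i +ℕ quad (val b +ℕ 3) j +ℕ 3 *ℕ k
        e₂ = quad (val b) i +ℕ quad 4 j +ℕ 3 *ℕ k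
        e₁′≡e₁ : e₁′ ≡ e₁
        e₁′≡e₁ = cong (_+ℕ 3 *ℕ k) (trans (ℕ.+-assoc (3 *ℕ i *ℕ i ∸ 2 *ℕ i) _ _)
          (cong₂ _+ℕ_ (3i²∸drop≡quad one i) (3j²+linear≡quad b j)))

    P-3N+1-one-one : ∀ x y → Pᶜ (3 *ℕ N +ℕ 1) one x one y ≡
      sum4 N (λ i j k l → qMultinom4 (q ^ 6) N i j k l
        * q ^ ((3 *ℕ i *ℕ i ∸ 2 *ℕ i) +ℕ 3 *ℕ j *ℕ j +ℕ j +ℕ 3 *ℕ k)
        * (x ^ i * y ^ j + x ^ suc j * y ^ i * q ^ (3 *ℕ N +ℕ 1)))
    P-3N+1-one-one x y =
      P-3N+1-one one x y (λ _ _ → 3 *ℕ N +ℕ 1) λ i j k l _ → shift (quad 1 i +ℕ quad 4 j +ℕ 3 *ℕ k) N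
      where
      shift : ∀ e N → e +ℕ (3 *ℕ N +ℕ 1) ≡ 1 +ℕ 3 *ℕ N +ℕ e
      shift = solve-∀

    P-3N+1-one-two : ∀ x y → Pᶜ (3 *ℕ N +ℕ 1) one x two y ≡
      sum4 N (λ i j k l → qMultinom4 (q ^ 6) N i j k l
        * q ^ ((3 *ℕ i *ℕ i ∸ 2 *ℕ i) +ℕ 3 *ℕ j *ℕ j +ℕ 2 *ℕ j +ℕ 3 *ℕ k)
        * (x ^ i * y ^ j + x ^ suc j * y ^ i * q ^ ((i +ℕ 3 *ℕ N +ℕ 1) ∸ j)))
    P-3N+1-one-two x y = P-3N+1-one two x y (λ i j → (i +ℕ 3 *ℕ N +ℕ 1) ∸ j) shift
      where
      regroup₁ : ∀ A B k j D → A +ℕ (1 *ℕ j +ℕ B) +ℕ 3 *ℕ k +ℕ D ≡ A +ℕ B +ℕ 3 *ℕ k +ℕ (j +ℕ D)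
      regroup₁ = solve-∀
      regroup₂ : ∀ A B k i N →
        A +ℕ B +ℕ 3 *ℕ k +ℕ (i +ℕ 3 *ℕ N +ℕ 1) ≡ 1 +ℕ 3 *ℕ N +ℕ (1 *ℕ i +ℕ A +ℕ B +ℕ 3 *ℕ k)
      regroup₂ = solve-∀
      shift : ∀ i j k l → i +ℕ (j +ℕ (k +ℕ l)) ≡ N →
        quad 1 i +ℕ quad 5 j +ℕ 3 *ℕ k +ℕ ((i +ℕ 3 *ℕ N +ℕ 1) ∸ j)
          ≡ 1 +ℕ 3 *ℕ N +ℕ (quad 2 i +ℕ quad 4 j +ℕ 3 *ℕ k)
      shift i j k l e = begin
        quad 1 i +ℕ quad 5 j +ℕ 3 *ℕ k +ℕ D
          ≡⟨ cong (λ z → quad 1 i +ℕ z +ℕ 3 *ℕ k +ℕ D) (quad-+ 4 1 j) ⟩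
        quad 1 i +ℕ (1 *ℕ j +ℕ quad 4 j) +ℕ 3 *ℕ k +ℕ D
          ≡⟨ regroup₁ (quad 1 i) (quad 4 j) k j D ⟩
        quad 1 i +ℕ quad 4 j +ℕ 3 *ℕ k +ℕ (j +ℕ D)
          ≡⟨ cong (quad 1 i +ℕ quad 4 j +ℕ 3 *ℕ k +ℕ_) (ℕ.m+[n∸m]≡n j≤) ⟩
        quad 1 i +ℕ quad 4 j +ℕ 3 *ℕ k +ℕ (i +ℕ 3 *ℕ N +ℕ 1)
          ≡⟨ regroup₂ (quad 1 i) (quad 4 j) k i N ⟩
        1 +ℕ 3 *ℕ N +ℕ (1 *ℕ i +ℕ quad 1 i +ℕ quad 4 j +ℕ 3 *ℕ k)
          ≡⟨ cong (λ z → 1 +ℕ 3 *ℕ N +ℕ (z +ℕ quad 4 j +ℕ 3 *ℕ k)) (sym (quad-+ 1 1 i)) ⟩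
        1 +ℕ 3 *ℕ N +ℕ (quad 2 i +ℕ quad 4 j +ℕ 3 *ℕ k) ∎
        where
        D = (i +ℕ 3 *ℕ N +ℕ 1) ∸ j
        j≤ : j ≤ i +ℕ 3 *ℕ N +ℕ 1
        j≤ = ℕ.≤-trans (subst (j ≤_) e (ℕ.≤-trans (ℕ.m≤m+n j (k +ℕ l)) (ℕ.m≤n+m _ i)))
               (ℕ.≤-trans (ℕ.m≤n*m N 3) (ℕ.≤-trans (ℕ.m≤n+m (3 *ℕ N) i) (ℕ.m≤m+n (i +ℕ 3 *ℕ N) 1)))

open import Defs
open import Data.Nat using (ℕ; suc; _+_; _*_; _∸_; _≤_)
open import Data.Integer using (+_)
open import Data.Rational using (ℚ; 0ℚ; 1ℚ) renaming (_+_ to _+ℚ_; _*_ to _*ℚ_; _/_ to _/ℚ_)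
open import Data.Product using (_×_; _,_)
open import Data.Sum using (_⊎_)
open import Relation.Binary.PropositionalEquality using (_≡_; _≢_)

theorem3p10 :
  (N : ℕ) (s t u v q : ℚ) →
  (∀ m → 1 ≤ m → m ≤ N → (q ^ 6) ^ m ≢ 1ℚ) →
  ((μ : ℕ) → μ ≡ 0 ⊎ μ ≡ 2 →
    (P (3 * N + μ) 0ℚ t u 0ℚ q
      ≡ (1ℚ +ℚ ((+ μ) /ℚ 2) *ℚ t *ℚ (q ^ 2)) *ℚ
        sum4 N (λ i j k l → qMultinom4 (q ^ 6) N i j k l *ℚ (t ^ i) *ℚ (u ^ j)
          *ℚ (q ^ ((3 * i * i + 3 * μ * i ∸ i) + 3 * j * j + j + 3 * k))))
    × (P (3 * N + μ) s 0ℚ 0ℚ v q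
      ≡ (1ℚ +ℚ ((+ μ) /ℚ 2) *ℚ s *ℚ q) *ℚ
        sum4 N (λ i j k l → qMultinom4 (q ^ 6) N i j k l *ℚ (s ^ i) *ℚ (v ^ j)
          *ℚ (q ^ ((3 * i * i + 3 * μ * i ∸ 2 * i) + 3 * j * j + 2 * j + 3 * k))))
    × (P (3 * N + μ) s 0ℚ u 0ℚ q
      ≡ (1ℚ +ℚ ((+ μ) /ℚ 2) *ℚ s *ℚ q) *ℚ
        sum4 N (λ i j k l → qMultinom4 (q ^ 6) N i j k l *ℚ (s ^ i) *ℚ (u ^ j)
          *ℚ (q ^ ((3 * i * i + 3 * μ * i ∸ 2 * i) + 3 * j * j + j + 3 * k))))
    × (P (3 * N + μ) 0ℚ t 0ℚ v q
      ≡ (1ℚ +ℚ ((+ μ) /ℚ 2) *ℚ t *ℚ (q ^ 2)) *ℚ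
        sum4 N (λ i j k l → qMultinom4 (q ^ 6) N i j k l *ℚ (t ^ i) *ℚ (v ^ j)
          *ℚ (q ^ ((3 * i * i + 3 * μ * i ∸ i) + 3 * j * j + 2 * j + 3 * k)))))
  × (P (3 * N + 1) 0ℚ t u 0ℚ q
      ≡ sum4 N (λ i j k l → qMultinom4 (q ^ 6) N i j k l *ℚ (t ^ i) *ℚ (u ^ j)
          *ℚ (q ^ ((3 * i * i ∸ i) + 3 * j * j + j + 3 * k))))
  × (P (3 * N + 1) s 0ℚ 0ℚ v q
      ≡ sum4 N (λ i j k l → qMultinom4 (q ^ 6) N i j k l
          *ℚ (q ^ ((3 * i * i ∸ 2 * i) + 3 * j * j + 2 * j + 3 * k))
          *ℚ ((s ^ i) *ℚ (v ^ j)
              +ℚ (s ^ suc j) *ℚ (v ^ i) *ℚ (q ^ ((i + 3 * N + 1) ∸ j)))))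
  × (P (3 * N + 1) s 0ℚ u 0ℚ q
      ≡ sum4 N (λ i j k l → qMultinom4 (q ^ 6) N i j k l
          *ℚ (q ^ ((3 * i * i ∸ 2 * i) + 3 * j * j + j + 3 * k))
          *ℚ ((s ^ i) *ℚ (u ^ j)
              +ℚ (s ^ suc j) *ℚ (u ^ i) *ℚ (q ^ (3 * N + 1)))))
  × (P (3 * N + 1) 0ℚ t 0ℚ v q
      ≡ sum4 N (λ i j k l → qMultinom4 (q ^ 6) N i j k l *ℚ (t ^ i) *ℚ (v ^ j)
          *ℚ (q ^ ((3 * i * i ∸ i) + 3 * j * j + 2 * j + 3 * k))))
theorem3p10 N s t u v q h =
  (λ μ μ∈ → P-3N+μ N h μ μ∈ two t one u , P-3N+μ N h μ μ∈ one s two v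
          , P-3N+μ N h μ μ∈ one s one u , P-3N+μ N h μ μ∈ two t two v)
  , P-3N+1-two N h one t u , P-3N+1-one-two N h s v , P-3N+1-one-one N h s u , P-3N+1-two N h two t v
  where
  open Exponents using (one; two)
  open ColouredPartitions q
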